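{- Let $T_1$-$CSC$ be the set of indices of $T_1$ CSC spaces and $T_0$-$CSC$ the set of indices of $T_0$ CSC spaces. Then $T_1$-$CSC$ is $\Pi^0_2$-complete within $T_0$-$CSC$.
   Context: $(\Phi_e)_{e\in\omega}$ is a standard enumeration of the partial computable functions and $\langle\cdot,\cdot\rangle$ a computable pairing function. A CSC (countable second-countable) space consists of a set of points coded by natural numbers, a sequence $\mathcal U=(U_i)_{i\in\omega}$ of sets of points, and a function $k$ such that every point lies in some $U_i$ and whenever $x\in U_i\cap U_j$ we have $x\in U_{k(i,j,x)}\subseteq U_i\cap U_j$; its topology is the one generated by the base $\mathcal U$. An index for a CSC space is a pair $\langle m,n\rangle$ such that $\Phi_m$ is total with $\Phi_m(i,x)=1$ iff $x\in U_i$ and $\Phi_m(i,x)=0$ iff $x\notin U_i$, and $\Phi_n$ is total and computes such a function $k$. For a complexity class $\Gamma$ and sets $A\subseteq C\subseteq\omega$: $A$ is $\Gamma$ within $C$ if $A=B\cap C$ for some $B\in\Gamma$; $A$ is $\Gamma$-hard within $C$ if for every $B\in\Gamma$ there is a total computable $f$ such that for all $e$, $f(e)\in C$ and ($e\in B\iff f(e)\in A$); $A$ is $\Gamma$-complete within $C$ if it is both. -}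

module Defs where

open import Level using (Level; 0ℓ) renaming (suc to lsuc)
open import Data.Nat using (ℕ; zero; suc; _+_)
open import Data.Maybe using (Maybe; just; nothing; _>>=_)
open import Data.Product using (Σ; ∃; ∃-syntax; _×_; _,_; proj₁; proj₂)
open import Data.Sum using (_⊎_)
open import Relation.Binary.PropositionalEquality using (_≡_)
open import Relation.Nullary using (¬_)
open import Function.Bundles using (_⇔_)

tri : ℕ → ℕ
tri zero    = zero
tri (suc n) = tri n + suc n

⟨_,_⟩ : ℕ → ℕ → ℕ
⟨ a , b ⟩ = tri (a + b) + b

-- inverse of ⟨_,_⟩, enumerating the diagonals (0,0),(1,0),(0,1),(2,0),…
unpair : ℕ → ℕ × ℕ
unpair zero = (0 , 0)
unpair (suc n) with unpair n
... | (zero  , b) = (suc b , 0)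
... | (suc a , b) = (a , suc b)

-- A model of (unary) partial recursive functions; several arguments are
-- coded with ⟨_,_⟩.

data Code : Set where
  cZero cSucc cId cFst cSnd : Code
  cComp cPair cPrec : Code → Code → Code
  cMu : Code → Code

eval : ℕ → Code → ℕ → Maybe ℕ
eval zero    _ _ = nothing
eval (suc s) cZero x = just 0
eval (suc s) cSucc x = just (suc x)
eval (suc s) cId x = just x
eval (suc s) cFst x = just (proj₁ (unpair x))
eval (suc s) cSnd x = just (proj₂ (unpair x))
eval (suc s) (cComp f g) x = eval s g x >>= eval s f
eval (suc s) (cPair f g) x =
  eval s f x >>= λ a → eval s g x >>= λ b → just ⟨ a , b ⟩
-- h ⟨ a , 0 ⟩ = f a ;  h ⟨ a , n+1 ⟩ = g ⟨ a , ⟨ n , h ⟨ a , n ⟩ ⟩ ⟩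
eval (suc s) (cPrec f g) x = rec (proj₂ (unpair x))
  where
  a = proj₁ (unpair x)
  rec : ℕ → Maybe ℕ
  rec zero    = eval s f a
  rec (suc n) = rec n >>= λ r → eval s g ⟨ a , ⟨ n , r ⟩ ⟩
-- μ n. f ⟨ x , n ⟩ = 0
eval (suc s) (cMu f) x = search s 0
  where
  search : ℕ → ℕ → Maybe ℕ
  search zero    _ = nothing
  search (suc t) k = eval s f ⟨ x , k ⟩ >>= λ where
    zero    → just k
    (suc _) → search t (suc k)

-- Gödel numbering of codes (every number decodes to some code)
decodeF : ℕ → ℕ → Code
decodeF zero    _ = cZero
decodeF (suc t) n with unpair n
... | (0 , _) = cZero
... | (1 , _) = cSucc
... | (2 , _) = cId
... | (3 , _) = cFst
... | (4 , _) = cSnd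
... | (5 , r) = cComp (decodeF t (proj₁ (unpair r))) (decodeF t (proj₂ (unpair r)))
... | (6 , r) = cPair (decodeF t (proj₁ (unpair r))) (decodeF t (proj₂ (unpair r)))
... | (7 , r) = cPrec (decodeF t (proj₁ (unpair r))) (decodeF t (proj₂ (unpair r)))
... | (_ , r) = cMu (decodeF t r)

decode : ℕ → Code
decode n = decodeF n n

_⟦_⟧↓_ : ℕ → ℕ → ℕ → Set
e ⟦ x ⟧↓ y = ∃[ s ] eval s (decode e) x ≡ just y

Total : ℕ → Set
Total e = ∀ x → ∃[ y ] e ⟦ x ⟧↓ y

Computable : (ℕ → ℕ) → Set
Computable f = ∃[ c ] (∀ x → c ⟦ x ⟧↓ f x)

-- CSC spaces given by a pair of indices m, n (points: all of ℕ)

_∈U[_]_ : ℕ → ℕ → ℕ → Set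
x ∈U[ m ] i = m ⟦ ⟨ i , x ⟩ ⟧↓ 1

IsCSC : ℕ → ℕ → Set
IsCSC m n =
    Total m
  × (∀ i x → (m ⟦ ⟨ i , x ⟩ ⟧↓ 0) ⊎ (m ⟦ ⟨ i , x ⟩ ⟧↓ 1))
  × Total n
  × (∀ x → ∃[ i ] x ∈U[ m ] i)
  × (∀ i j x → x ∈U[ m ] i → x ∈U[ m ] j → ∀ r → n ⟦ ⟨ i , ⟨ j , x ⟩ ⟩ ⟧↓ r →
       x ∈U[ m ] r × (∀ y → y ∈U[ m ] r → y ∈U[ m ] i × y ∈U[ m ] j))

IsOpen : ℕ → (ℕ → Set) → Set
IsOpen m O = ∀ x → O x → ∃[ i ] (x ∈U[ m ] i × (∀ y → y ∈U[ m ] i → O y))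

IsT0 : ℕ → Set₁
IsT0 m = ∀ x y → ¬ x ≡ y → ∃[ O ] (IsOpen m O × ((O x × ¬ O y) ⊎ (O y × ¬ O x)))

IsT1 : ℕ → Set₁
IsT1 m = ∀ x y → ¬ x ≡ y → ∃[ O ] (IsOpen m O × O x × ¬ O y)

T0-CSC : ℕ → Set₁
T0-CSC e = ∃[ m ] ∃[ n ] (e ≡ ⟨ m , n ⟩ × IsCSC m n × IsT0 m)

T1-CSC : ℕ → Set₁
T1-CSC e = ∃[ m ] ∃[ n ] (e ≡ ⟨ m , n ⟩ × IsCSC m n × IsT1 m)

IsΠ⁰₂ : (ℕ → Set₁) → Set₁
IsΠ⁰₂ B = ∃[ r ] (Total r ×
  (∀ e → B e ⇔ (∀ a → ∃[ b ] r ⟦ ⟨ e , ⟨ a , b ⟩ ⟩ ⟧↓ 0)))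

Π⁰₂-within : (ℕ → Set₁) → (ℕ → Set₁) → Set₂
Π⁰₂-within A C = ∃[ B ] (IsΠ⁰₂ B × (∀ e → A e ⇔ (B e × C e)))

Π⁰₂-hard-within : (ℕ → Set₁) → (ℕ → Set₁) → Set₂
Π⁰₂-hard-within A C = ∀ (B : ℕ → Set₁) → IsΠ⁰₂ B →
  ∃[ f ] (Computable f × (∀ e → C (f e) × (B e ⇔ A (f e))))

Π⁰₂-complete-within : (ℕ → Set₁) → (ℕ → Set₁) → Set₂
Π⁰₂-complete-within A C = Π⁰₂-within A C × Π⁰₂-hard-within A C

{-# OPTIONS --safe #-}

-- A T₀ CSC space with basis (U_i) given by Φ_m is T₁ iff for all points x ≠ y some U_i
-- contains x but not y. For a fixed i the two facts Φ_m⟨i,x⟩ = 1 and Φ_m⟨i,y⟩ = 0 have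
-- finite certificates: lists of instances of the big-step rules of eval, each justified by
-- entries further down the list. Validity of a certificate is decided by a primitive
-- recursive program, so "for every ⟨x,y⟩ there are i and a certificate" is Π⁰₂.
--
-- For hardness, given ∀a ∃b R(e,a,b) = 0, take the space on ℕ in which every ⟨a,k⟩ with
-- k ≠ 0 is isolated, while ⟨a,0⟩ has the neighbourhood {⟨a,0⟩, ⟨a,1⟩} and, for each b with
-- R(e,a,b) = 0, the neighbourhood {⟨a,0⟩}. This space is always T₀, and it is T₁ exactly
-- when every a has such a b. By the s-m-n theorem its basis and its intersection function
-- are computable uniformly in e.

module Submission where

open import Level using (Lift; lift; lower)
open import Data.Bool using (Bool; true; false; _∧_; _∨_; not; if_then_else_; T)
open import Data.Bool.Properties using (T-∨; T-∧; T?)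
open import Data.Empty using (⊥-elim)
open import Data.List using (List; []; _∷_; _++_)
open import Data.List.Relation.Unary.Any using (Any; here; there)
open import Data.List.Relation.Unary.Any.Properties using (++⁺ˡ; ++⁺ʳ)
open import Data.Maybe using (Maybe; just; _>>=_)
open import Data.Nat
open import Data.Nat.Properties
open import Data.Product using (Σ-syntax; ∃-syntax; _×_; _,_; proj₁; proj₂)
open import Data.Sum using (_⊎_; inj₁; inj₂)
open import Function using (_∘_; id)
open import Function.Bundles using (Equivalence; mk⇔)
open import Relation.Nullary using (¬_; yes; no)
open import Relation.Binary.PropositionalEquality

open import Defs

π₁ π₂ : ℕ → ℕ
π₁ n = proj₁ (unpair n)
π₂ n = proj₂ (unpair n)

pair-along-diagonal : ∀ a b → ⟨ a , suc b ⟩ ≡ suc ⟨ suc a , b ⟩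
pair-along-diagonal a b rewrite +-suc a b | +-suc (tri (suc (a + b))) b = refl

pair-next-diagonal : ∀ a → ⟨ suc a , 0 ⟩ ≡ suc ⟨ 0 , a ⟩
pair-next-diagonal a rewrite +-identityʳ a | +-identityʳ (tri a + suc a) | +-suc (tri a) a = refl

UnpairsAt : ℕ → ℕ → Set
UnpairsAt a b = unpair ⟨ a , b ⟩ ≡ (a , b)

-- Walking up the diagonal a + b = d from its first point ⟨ d , 0 ⟩.
unpair-pair-diagonal : ∀ b a → UnpairsAt (a + b) 0 → UnpairsAt a b
unpair-pair-diagonal zero a start = subst (λ d → UnpairsAt d 0) (+-identityʳ a) start
unpair-pair-diagonal (suc b) a start
  rewrite pair-along-diagonal a b
        | unpair-pair-diagonal b (suc a) (subst (λ d → UnpairsAt d 0) (+-suc a b) start) = refl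

unpair-pair-start : ∀ d → UnpairsAt d 0
unpair-pair-start zero = refl
unpair-pair-start (suc d) rewrite pair-next-diagonal d | unpair-pair-diagonal d 0 (unpair-pair-start d) = refl

unpair-pair : ∀ a b → UnpairsAt a b
unpair-pair a b = unpair-pair-diagonal b a (unpair-pair-start (a + b))

π₁-pair : ∀ a b → π₁ ⟨ a , b ⟩ ≡ a
π₁-pair a b = cong proj₁ (unpair-pair a b)

π₂-pair : ∀ a b → π₂ ⟨ a , b ⟩ ≡ b
π₂-pair a b = cong proj₂ (unpair-pair a b)

pair-π : ∀ n → ⟨ π₁ n , π₂ n ⟩ ≡ n
pair-π zero = refl
pair-π (suc n) with unpair n | pair-π n
... | zero  , b | eq = trans (pair-next-diagonal b) (cong suc eq)
... | suc a , b | eq = trans (pair-along-diagonal a b) (cong suc eq)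

pair-injective : ∀ {a b c d} → ⟨ a , b ⟩ ≡ ⟨ c , d ⟩ → a ≡ c × b ≡ d
pair-injective {a} {b} {c} {d} eq
  with trans (sym (unpair-pair a b)) (trans (cong unpair eq) (unpair-pair c d))
... | refl = refl , refl

n≤tri : ∀ n → n ≤ tri n
n≤tri zero = z≤n
n≤tri (suc n) = m≤n+m (suc n) (tri n)

+≤pair : ∀ a b → a + b ≤ ⟨ a , b ⟩
+≤pair a b = ≤-trans (n≤tri (a + b)) (m≤m+n (tri (a + b)) b)

+≤self : ∀ n → π₁ n + π₂ n ≤ n
+≤self n = ≤-trans (+≤pair (π₁ n) (π₂ n)) (≤-reflexive (pair-π n))

π₁≤ : ∀ n → π₁ n ≤ n
π₁≤ n = ≤-trans (m≤m+n (π₁ n) (π₂ n)) (+≤self n)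

π₂≤ : ∀ n → π₂ n ≤ n
π₂≤ n = ≤-trans (m≤n+m (π₂ n) (π₁ n)) (+≤self n)

π₂< : ∀ n → 0 < π₁ n → π₂ n < n
π₂< n 0<π₁ = ≤-trans (+-monoˡ-≤ (π₂ n) 0<π₁) (+≤self n)

infix 4 _⊢_⇓_

_⊢_⇓_ : Code → ℕ → ℕ → Set
c ⊢ x ⇓ y = ∃[ s ] eval s c x ≡ just y

NonzeroBelow : Code → ℕ → ℕ → Set
NonzeroBelow f x y = ∀ j → j < y → ∃[ v ] f ⊢ ⟨ x , j ⟩ ⇓ suc v

-- evalRec and evalSearch name the loops in the where blocks of the cPrec and cMu
-- clauses of eval; their bodies are left to unification, which the two equations
-- in this block force.
mutual
  evalRec : ℕ → Code → Code → ℕ → ℕ → Maybe ℕ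
  evalRec = _

  evalSearch : ℕ → Code → ℕ → ℕ → ℕ → Maybe ℕ
  evalSearch = _

  eval-cPrec : ∀ s f g x → eval (suc s) (cPrec f g) x ≡ evalRec s f g x (π₂ x)
  eval-cPrec s f g x with π₂ x
  ... | n = refl

  private
    eval-cMu-step : ∀ t f x v → eval (suc t) f ⟨ x , 0 ⟩ ≡ just (suc v) →
                    eval (suc (suc t)) (cMu f) x ≡ evalSearch (suc t) f x t 1
    eval-cMu-step t f x v eq with eval (suc t) f ⟨ x , 0 ⟩
    ... | just (suc w) with suc t | 1
    ... | s | k = refl

evalRec-cong : ∀ s f g x x′ n → π₁ x ≡ π₁ x′ → evalRec s f g x n ≡ evalRec s f g x′ n
evalRec-cong s f g x x′ zero eq = cong (eval s f) eq
evalRec-cong s f g x x′ (suc n) eq rewrite evalRec-cong s f g x x′ n eq | eq = refl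

evalSearch-found : ∀ s f x t k → eval s f ⟨ x , k ⟩ ≡ just 0 → evalSearch s f x (suc t) k ≡ just k
evalSearch-found s f x t k eq rewrite eq = refl

evalSearch-next : ∀ s f x t k v → eval s f ⟨ x , k ⟩ ≡ just (suc v) →
                  evalSearch s f x (suc t) k ≡ evalSearch s f x t (suc k)
evalSearch-next s f x t k v eq rewrite eq = refl

evalSearch-step⁻¹ : ∀ s f x t k y → evalSearch s f x (suc t) k ≡ just y →
  (eval s f ⟨ x , k ⟩ ≡ just 0 × k ≡ y) ⊎
  (∃[ v ] eval s f ⟨ x , k ⟩ ≡ just (suc v) × evalSearch s f x t (suc k) ≡ just y)
evalSearch-step⁻¹ s f x t k y eq with eval s f ⟨ x , k ⟩
evalSearch-step⁻¹ s f x t k y refl | just zero = inj₁ (refl , refl)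
evalSearch-step⁻¹ s f x t k y eq   | just (suc v) = inj₂ (v , refl , eq)

>>=-just⁻¹ : ∀ {m : Maybe ℕ} {k : ℕ → Maybe ℕ} {y} → (m >>= k) ≡ just y →
             ∃[ z ] m ≡ just z × k z ≡ just y
>>=-just⁻¹ {just z} eq = z , refl , eq

mutual
  eval-mono : ∀ s c x y → eval s c x ≡ just y → eval (suc s) c x ≡ just y
  eval-mono (suc s) cZero x y eq = eq
  eval-mono (suc s) cSucc x y eq = eq
  eval-mono (suc s) cId x y eq = eq
  eval-mono (suc s) cFst x y eq = eq
  eval-mono (suc s) cSnd x y eq = eq
  eval-mono (suc s) (cComp f g) x y eq with >>=-just⁻¹ {eval s g x} eq
  ... | z , gz , fy rewrite eval-mono s g x z gz = eval-mono s f z y fy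
  eval-mono (suc s) (cPair f g) x y eq with >>=-just⁻¹ {eval s f x} eq
  ... | a , fa , rest with >>=-just⁻¹ {eval s g x} rest
  ... | b , gb , ab rewrite eval-mono s f x a fa | eval-mono s g x b gb = ab
  eval-mono (suc s) (cPrec f g) x y eq =
    trans (eval-cPrec (suc s) f g x) (evalRec-mono s f g x (π₂ x) y (trans (sym (eval-cPrec s f g x)) eq))
  eval-mono (suc s) (cMu f) x y eq = evalSearch-mono s f x s 0 y eq

  evalRec-mono : ∀ s f g x n y → evalRec s f g x n ≡ just y → evalRec (suc s) f g x n ≡ just y
  evalRec-mono s f g x zero y eq = eval-mono s f _ y eq
  evalRec-mono s f g x (suc n) y eq with >>=-just⁻¹ {evalRec s f g x n} eq
  ... | r , rec , gy rewrite evalRec-mono s f g x n r rec = eval-mono s g _ y gy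

  evalSearch-mono : ∀ s f x t k y → evalSearch s f x t k ≡ just y → evalSearch (suc s) f x (suc t) k ≡ just y
  evalSearch-mono s f x (suc t) k y eq with evalSearch-step⁻¹ s f x t k y eq
  ... | inj₁ (fk , refl) = evalSearch-found (suc s) f x (suc t) k (eval-mono s f _ 0 fk)
  ... | inj₂ (v , fk , rest) =
    trans (evalSearch-next (suc s) f x (suc t) k v (eval-mono s f _ _ fk))
          (evalSearch-mono s f x t (suc k) y rest)

eval-mono-≤ : ∀ {s s′} c x {y} → s ≤ s′ → eval s c x ≡ just y → eval s′ c x ≡ just y
eval-mono-≤ {s} c x {y} s≤s′ eq with m≤n⇒∃[o]m+o≡n s≤s′
... | o , refl = go o
  where
  go : ∀ o → eval (s + o) c x ≡ just y
  go zero rewrite +-identityʳ s = eq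
  go (suc o) rewrite +-suc s o = eval-mono (s + o) c x y (go o)

evalRec-mono-≤ : ∀ {s s′} f g x n {y} → s ≤ s′ → evalRec s f g x n ≡ just y → evalRec s′ f g x n ≡ just y
evalRec-mono-≤ {s} f g x n {y} s≤s′ eq with m≤n⇒∃[o]m+o≡n s≤s′
... | o , refl = go o
  where
  go : ∀ o → evalRec (s + o) f g x n ≡ just y
  go zero rewrite +-identityʳ s = eq
  go (suc o) rewrite +-suc s o = evalRec-mono (s + o) f g x n y (go o)

⇓-functional : ∀ {c x y y′} → c ⊢ x ⇓ y → c ⊢ x ⇓ y′ → y ≡ y′
⇓-functional {c} {x} {y} {y′} (s , e) (s′ , e′) =
  just-injective (trans (sym (eval-mono-≤ c x (m≤m⊔n s s′) e)) (eval-mono-≤ c x (m≤n⊔m s s′) e′))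
  where
  just-injective : ∀ {a b : ℕ} → _≡_ {A = Maybe ℕ} (just a) (just b) → a ≡ b
  just-injective refl = refl

⇓-cComp : ∀ {f g x z y} → g ⊢ x ⇓ z → f ⊢ z ⇓ y → cComp f g ⊢ x ⇓ y
⇓-cComp {f} {g} {x} {z} {y} (s₁ , gz) (s₂ , fy) = suc (s₁ ⊔ s₂) , (begin
  (eval (s₁ ⊔ s₂) g x >>= eval (s₁ ⊔ s₂) f)
    ≡⟨ cong (_>>= eval (s₁ ⊔ s₂) f) (eval-mono-≤ g x (m≤m⊔n s₁ s₂) gz) ⟩
  eval (s₁ ⊔ s₂) f z
    ≡⟨ eval-mono-≤ f z (m≤n⊔m s₁ s₂) fy ⟩
  just y ∎)
  where open ≡-Reasoning

⇓-cPair : ∀ {f g x a b} → f ⊢ x ⇓ a → g ⊢ x ⇓ b → cPair f g ⊢ x ⇓ ⟨ a , b ⟩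
⇓-cPair {f} {g} {x} (s₁ , fa) (s₂ , gb) = suc (s₁ ⊔ s₂) , pair-evaluates
  where
  pair-evaluates : eval (suc (s₁ ⊔ s₂)) (cPair f g) x ≡ just _
  pair-evaluates rewrite eval-mono-≤ f x (m≤m⊔n s₁ s₂) fa | eval-mono-≤ g x (m≤n⊔m s₁ s₂) gb = refl

⇓-cPrec-zero : ∀ {f g a y} → f ⊢ a ⇓ y → cPrec f g ⊢ ⟨ a , 0 ⟩ ⇓ y
⇓-cPrec-zero {f} {g} {a} (s , fy) = suc s , trans (eval-cPrec s f g ⟨ a , 0 ⟩) base
  where
  base : evalRec s f g ⟨ a , 0 ⟩ (π₂ ⟨ a , 0 ⟩) ≡ just _
  base rewrite π₂-pair a 0 | π₁-pair a 0 = fy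

⇓-cPrec-suc : ∀ {f g a n h y} → cPrec f g ⊢ ⟨ a , n ⟩ ⇓ h → g ⊢ ⟨ a , ⟨ n , h ⟩ ⟩ ⇓ y →
              cPrec f g ⊢ ⟨ a , suc n ⟩ ⇓ y
⇓-cPrec-suc {f} {g} {a} {n} {h} (suc s₁ , fn) (s₂ , gy) =
  suc (s₁ ⊔ s₂) , trans (eval-cPrec (s₁ ⊔ s₂) f g ⟨ a , suc n ⟩) step
  where
  previous : evalRec s₁ f g ⟨ a , suc n ⟩ n ≡ just h
  previous = begin
    evalRec s₁ f g ⟨ a , suc n ⟩ n
      ≡⟨ evalRec-cong s₁ f g ⟨ a , suc n ⟩ ⟨ a , n ⟩ n (trans (π₁-pair a (suc n)) (sym (π₁-pair a n))) ⟩
    evalRec s₁ f g ⟨ a , n ⟩ n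
      ≡⟨ cong (evalRec s₁ f g ⟨ a , n ⟩) (sym (π₂-pair a n)) ⟩
    evalRec s₁ f g ⟨ a , n ⟩ (π₂ ⟨ a , n ⟩)
      ≡⟨ trans (sym (eval-cPrec s₁ f g ⟨ a , n ⟩)) fn ⟩
    just h ∎
    where open ≡-Reasoning
  step : evalRec (s₁ ⊔ s₂) f g ⟨ a , suc n ⟩ (π₂ ⟨ a , suc n ⟩) ≡ just _
  step rewrite π₂-pair a (suc n) | evalRec-mono-≤ f g ⟨ a , suc n ⟩ n (m≤m⊔n s₁ s₂) previous
             | π₁-pair a (suc n) = eval-mono-≤ g _ (m≤n⊔m s₁ s₂) gy

evalSearch-succeeds : ∀ {f x y} → NonzeroBelow f x y → f ⊢ ⟨ x , y ⟩ ⇓ 0 →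
  ∀ d k → d + k ≡ y → ∃[ S ] ∀ {s t} → S ≤ s → d < t → evalSearch s f x t k ≡ just y
evalSearch-succeeds {f} {x} nonzero (s₀ , zero-at-y) zero k refl = s₀ , found
  where
  found : ∀ {s t} → s₀ ≤ s → 0 < t → evalSearch s f x t k ≡ just k
  found {s} {suc t} s₀≤s _ = evalSearch-found s f x t k (eval-mono-≤ f _ s₀≤s zero-at-y)
evalSearch-succeeds {f} {x} nonzero at-y (suc d) k d+k≡y
  with nonzero k (subst (k <_) d+k≡y (m<n+m k z<s))
     | evalSearch-succeeds nonzero at-y d (suc k) (trans (+-suc d k) d+k≡y)
... | v , s₁ , nonzero-at-k | S , later = s₁ ⊔ S , next
  where
  next : ∀ {s t} → s₁ ⊔ S ≤ s → suc d < t → evalSearch s f x t k ≡ just _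
  next {s} {suc t} bound (s≤s d<t) =
    trans (evalSearch-next s f x t k v (eval-mono-≤ f _ (m⊔n≤o⇒m≤o s₁ S bound) nonzero-at-k))
          (later (m⊔n≤o⇒n≤o s₁ S bound) d<t)

⇓-cMu : ∀ {f x y} → NonzeroBelow f x y → f ⊢ ⟨ x , y ⟩ ⇓ 0 → cMu f ⊢ x ⇓ y
⇓-cMu {f} {x} {y} nonzero at-y with evalSearch-succeeds nonzero at-y y 0 (+-identityʳ y)
... | S , search = suc (S ⊔ suc y) , search (m≤m⊔n S (suc y)) (m≤n⊔m S (suc y))

evalSearch⁻¹ : ∀ s f x t k {y} → evalSearch s f x t k ≡ just y →
  k ≤ y × (∀ j → k ≤ j → j < y → ∃[ v ] eval s f ⟨ x , j ⟩ ≡ just (suc v)) ×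
  eval s f ⟨ x , y ⟩ ≡ just 0
evalSearch⁻¹ s f x (suc t) k {y} eq with evalSearch-step⁻¹ s f x t k y eq
... | inj₁ (zero-at-k , refl) = ≤-refl , (λ j k≤j j<k → ⊥-elim (<⇒≱ j<k k≤j)) , zero-at-k
... | inj₂ (v , nonzero-at-k , rest) with evalSearch⁻¹ s f x t (suc k) rest
... | k<y , nonzero-after , zero-at-y = ≤-trans (n≤1+n k) k<y , nonzero-from-k , zero-at-y
  where
  nonzero-from-k : ∀ j → k ≤ j → j < y → ∃[ v ] eval s f ⟨ x , j ⟩ ≡ just (suc v)
  nonzero-from-k j k≤j j<y with m≤n⇒m<n∨m≡n k≤j
  ... | inj₁ k<j = nonzero-after j k<j j<y
  ... | inj₂ refl = v , nonzero-at-k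

decodeStep : (ℕ → Code) → ℕ × ℕ → Code
decodeStep d (0 , _) = cZero
decodeStep d (1 , _) = cSucc
decodeStep d (2 , _) = cId
decodeStep d (3 , _) = cFst
decodeStep d (4 , _) = cSnd
decodeStep d (5 , r) = cComp (d (π₁ r)) (d (π₂ r))
decodeStep d (6 , r) = cPair (d (π₁ r)) (d (π₂ r))
decodeStep d (7 , r) = cPrec (d (π₁ r)) (d (π₂ r))
decodeStep d (_ , r) = cMu (d r)

decodeF-suc : ∀ t n → decodeF (suc t) n ≡ decodeStep (decodeF t) (unpair n)
decodeF-suc t n with unpair n
... | 0 , r = refl
... | 1 , r = refl
... | 2 , r = refl
... | 3 , r = refl
... | 4 , r = refl
... | 5 , r = refl
... | 6 , r = refl
... | 7 , r = refl
... | suc (suc (suc (suc (suc (suc (suc (suc k))))))) , r = refl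

argument< : ∀ n {k r} → unpair n ≡ (suc k , r) → r < n
argument< n eq = subst (_< n) (cong proj₂ eq) (π₂< n (subst (0 <_) (sym (cong proj₁ eq)) z<s))

argument₁< : ∀ n {k r} → unpair n ≡ (suc k , r) → π₁ r < n
argument₁< n {r = r} eq = ≤-<-trans (π₁≤ r) (argument< n eq)

argument₂< : ∀ n {k r} → unpair n ≡ (suc k , r) → π₂ r < n
argument₂< n {r = r} eq = ≤-<-trans (π₂≤ r) (argument< n eq)

decodeStep-cong : ∀ d d′ n → (∀ m → m < n → d m ≡ d′ m) →
                  decodeStep d (unpair n) ≡ decodeStep d′ (unpair n)
decodeStep-cong d d′ n agree with unpair n in eq
... | 0 , r = refl
... | 1 , r = refl
... | 2 , r = refl
... | 3 , r = refl
... | 4 , r = refl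
... | 5 , r = cong₂ cComp (agree _ (argument₁< n eq)) (agree _ (argument₂< n eq))
... | 6 , r = cong₂ cPair (agree _ (argument₁< n eq)) (agree _ (argument₂< n eq))
... | 7 , r = cong₂ cPrec (agree _ (argument₁< n eq)) (agree _ (argument₂< n eq))
... | suc (suc (suc (suc (suc (suc (suc (suc k))))))) , r = cong cMu (agree _ (argument< n eq))

decodeF-0 : ∀ t → decodeF t 0 ≡ cZero
decodeF-0 zero = refl
decodeF-0 (suc t) = refl

decodeF-fuel : ∀ t t′ n → n ≤ t → n ≤ t′ → decodeF t n ≡ decodeF t′ n
decodeF-fuel zero t′ zero _ _ = sym (decodeF-0 t′)
decodeF-fuel (suc t) zero zero _ _ = decodeF-0 (suc t)
decodeF-fuel (suc t) (suc t′) n n≤t n≤t′ = begin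
  decodeF (suc t) n                  ≡⟨ decodeF-suc t n ⟩
  decodeStep (decodeF t) (unpair n)  ≡⟨ decodeStep-cong (decodeF t) (decodeF t′) n agree ⟩
  decodeStep (decodeF t′) (unpair n) ≡⟨ decodeF-suc t′ n ⟨
  decodeF (suc t′) n                 ∎
  where
  open ≡-Reasoning
  agree : ∀ m → m < n → decodeF t m ≡ decodeF t′ m
  agree m m<n = decodeF-fuel t t′ m (≤-pred (≤-trans m<n n≤t)) (≤-pred (≤-trans m<n n≤t′))

decode-unfold : ∀ n → decode n ≡ decodeStep decode (unpair n)
decode-unfold zero = refl
decode-unfold (suc t) = trans (decodeF-suc t (suc t)) (decodeStep-cong (decodeF t) decode (suc t) agree)
  where
  agree : ∀ m → m < suc t → decodeF t m ≡ decode m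
  agree m m<1+t = decodeF-fuel t m m (≤-pred m<1+t) ≤-refl

encode : Code → ℕ
encode cZero = ⟨ 0 , 0 ⟩
encode cSucc = ⟨ 1 , 0 ⟩
encode cId = ⟨ 2 , 0 ⟩
encode cFst = ⟨ 3 , 0 ⟩
encode cSnd = ⟨ 4 , 0 ⟩
encode (cComp f g) = ⟨ 5 , ⟨ encode f , encode g ⟩ ⟩
encode (cPair f g) = ⟨ 6 , ⟨ encode f , encode g ⟩ ⟩
encode (cPrec f g) = ⟨ 7 , ⟨ encode f , encode g ⟩ ⟩
encode (cMu f) = ⟨ 8 , encode f ⟩

decode-encode : ∀ c → decode (encode c) ≡ c
decode-encode c = trans (decode-unfold (encode c)) (step c)
  where
  step : ∀ c → decodeStep decode (unpair (encode c)) ≡ c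
  step cZero = refl
  step cSucc rewrite unpair-pair 1 0 = refl
  step cId rewrite unpair-pair 2 0 = refl
  step cFst rewrite unpair-pair 3 0 = refl
  step cSnd rewrite unpair-pair 4 0 = refl
  step (cComp f g) rewrite unpair-pair 5 ⟨ encode f , encode g ⟩ | unpair-pair (encode f) (encode g)
    | decode-encode f | decode-encode g = refl
  step (cPair f g) rewrite unpair-pair 6 ⟨ encode f , encode g ⟩ | unpair-pair (encode f) (encode g)
    | decode-encode f | decode-encode g = refl
  step (cPrec f g) rewrite unpair-pair 7 ⟨ encode f , encode g ⟩ | unpair-pair (encode f) (encode g)
    | decode-encode f | decode-encode g = refl
  step (cMu f) rewrite unpair-pair 8 (encode f) | decode-encode f = refl

infixr 5 _⊗_

data Ty : Set where
  ℕᵗ : Ty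
  _⊗_ : Ty → Ty → Ty

El : Ty → Set
El ℕᵗ = ℕ
El (σ ⊗ τ) = El σ × El τ

code : ∀ τ → El τ → ℕ
code ℕᵗ n = n
code (σ ⊗ τ) (a , b) = ⟨ code σ a , code τ b ⟩

Prog : ∀ τ → (El τ → ℕ) → Set
Prog τ F = Σ[ c ∈ Code ] ∀ a → c ⊢ code τ a ⇓ F a

boolToℕ : Bool → ℕ
boolToℕ false = 0
boolToℕ true = 1

ProgB : ∀ τ → (El τ → Bool) → Set
ProgB τ P = Prog τ (λ a → boolToℕ (P a))

variable
  σ τ : Ty

castP : {F G : El σ → ℕ} → (∀ a → F a ≡ G a) → Prog σ F → Prog σ G
castP {σ} F≗G (c , computes) = c , λ a → subst (c ⊢ code σ a ⇓_) (F≗G a) (computes a)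

constCode : ℕ → Code
constCode zero = cZero
constCode (suc n) = cComp cSucc (constCode n)

constCode-⇓ : ∀ n x → constCode n ⊢ x ⇓ n
constCode-⇓ zero x = 1 , refl
constCode-⇓ (suc n) x = ⇓-cComp (constCode-⇓ n x) (1 , refl)

constP : ∀ n → Prog σ (λ _ → n)
constP n = constCode n , λ a → constCode-⇓ n _

selfP : Prog σ (code σ)
selfP = cId , λ a → 1 , refl

sucP : Prog ℕᵗ suc
sucP = cSucc , λ x → 1 , refl

π₁P : Prog ℕᵗ π₁
π₁P = cFst , λ x → 1 , refl

π₂P : Prog ℕᵗ π₂
π₂P = cSnd , λ x → 1 , refl

fstP : Prog (σ ⊗ τ) (λ t → code σ (proj₁ t))
fstP {σ} {τ} = cFst , λ t → 1 , cong just (π₁-pair (code σ (proj₁ t)) (code τ (proj₂ t)))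

sndP : Prog (σ ⊗ τ) (λ t → code τ (proj₂ t))
sndP {σ} {τ} = cSnd , λ t → 1 , cong just (π₂-pair (code σ (proj₁ t)) (code τ (proj₂ t)))

pairP : {F G : El σ → ℕ} → Prog σ F → Prog σ G → Prog σ (λ a → ⟨ F a , G a ⟩)
pairP (cf , f-computes) (cg , g-computes) = cPair cf cg , λ a → ⇓-cPair (f-computes a) (g-computes a)

compP : {H : El τ → ℕ} (f : El σ → El τ) → Prog τ H → Prog σ (λ a → code τ (f a)) →
        Prog σ (λ a → H (f a))
compP f (ch , h-computes) (cf , f-computes) = cComp ch cf , λ a → ⇓-cComp (f-computes a) (h-computes (f a))

app₁ : {H : ℕ → ℕ} {F : El σ → ℕ} → Prog ℕᵗ H → Prog σ F → Prog σ (λ a → H (F a))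
app₁ {F = F} = compP F

app₂ : {H : ℕ × ℕ → ℕ} {F G : El σ → ℕ} → Prog (ℕᵗ ⊗ ℕᵗ) H → Prog σ F → Prog σ G →
       Prog σ (λ a → H (F a , G a))
app₂ {F = F} {G} h f g = compP (λ a → F a , G a) h (pairP f g)

primRec : {A : Set} → (A → ℕ) → (A × ℕ × ℕ → ℕ) → A → ℕ → ℕ
primRec F G a zero = F a
primRec F G a (suc n) = G (a , n , primRec F G a n)

precP : {F : El σ → ℕ} {G : El (σ ⊗ ℕᵗ ⊗ ℕᵗ) → ℕ} → Prog σ F → Prog (σ ⊗ ℕᵗ ⊗ ℕᵗ) G →
        Prog (σ ⊗ ℕᵗ) (λ t → primRec F G (proj₁ t) (proj₂ t))
precP {σ} {F} {G} (cf , f-computes) (cg , g-computes) = cPrec cf cg , λ t → recursion (proj₁ t) (proj₂ t)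
  where
  recursion : ∀ a n → cPrec cf cg ⊢ ⟨ code σ a , n ⟩ ⇓ primRec F G a n
  recursion a zero = ⇓-cPrec-zero (f-computes a)
  recursion a (suc n) = ⇓-cPrec-suc {a = code σ a} (recursion a n) (g-computes (a , n , primRec F G a n))

ifz : ℕ → ℕ → ℕ → ℕ
ifz zero    a b = a
ifz (suc _) a b = b

ifzP : {F G H : El σ → ℕ} → Prog σ F → Prog σ G → Prog σ H → Prog σ (λ a → ifz (F a) (G a) (H a))
ifzP {F = F} {G} {H} f g h =
  compP (λ a → (G a , H a) , F a) (castP select (precP fstP (compP proj₁ sndP fstP))) (pairP (pairP g h) f)
  where
  select : ∀ t → primRec proj₁ (λ u → proj₂ (proj₁ u)) (proj₁ t) (proj₂ t)
                 ≡ ifz (proj₂ t) (proj₁ (proj₁ t)) (proj₂ (proj₁ t))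
  select (_ , zero) = refl
  select (_ , suc n) = refl

ifP : {P : El σ → Bool} {F G : El σ → ℕ} → ProgB σ P → Prog σ F → Prog σ G →
      Prog σ (λ a → if P a then F a else G a)
ifP {P = P} p f g = castP (λ a → ifz-boolToℕ (P a)) (ifzP p g f)
  where
  ifz-boolToℕ : ∀ {m n} b → ifz (boolToℕ b) m n ≡ (if b then n else m)
  ifz-boolToℕ false = refl
  ifz-boolToℕ true = refl

ifᵇP : {P Q R : El σ → Bool} → ProgB σ P → ProgB σ Q → ProgB σ R →
       ProgB σ (λ a → if P a then Q a else R a)
ifᵇP {P = P} p q r = castP (λ a → boolToℕ-if (P a)) (ifP p q r)
  where
  boolToℕ-if : ∀ {b c} a → (if a then boolToℕ b else boolToℕ c) ≡ boolToℕ (if a then b else c)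
  boolToℕ-if false = refl
  boolToℕ-if true = refl

notP : {P : El σ → Bool} → ProgB σ P → ProgB σ (λ a → not (P a))
notP {P = P} p = castP (λ a → boolToℕ-not (P a)) (ifP p (constP 0) (constP 1))
  where
  boolToℕ-not : ∀ b → (if b then 0 else 1) ≡ boolToℕ (not b)
  boolToℕ-not false = refl
  boolToℕ-not true = refl

andP : {P Q : El σ → Bool} → ProgB σ P → ProgB σ Q → ProgB σ (λ a → P a ∧ Q a)
andP {P = P} p q = castP (λ a → boolToℕ-∧ (P a)) (ifP p q (constP 0))
  where
  boolToℕ-∧ : ∀ {c} b → (if b then boolToℕ c else 0) ≡ boolToℕ (b ∧ c)
  boolToℕ-∧ false = refl
  boolToℕ-∧ true = refl

orP : {P Q : El σ → Bool} → ProgB σ P → ProgB σ Q → ProgB σ (λ a → P a ∨ Q a)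
orP {P = P} p q = castP (λ a → boolToℕ-∨ (P a)) (ifP p (constP 1) q)
  where
  boolToℕ-∨ : ∀ {c} b → (if b then 1 else boolToℕ c) ≡ boolToℕ (b ∨ c)
  boolToℕ-∨ false = refl
  boolToℕ-∨ true = refl

isZeroP : {F : El σ → ℕ} → Prog σ F → ProgB σ (λ a → F a ≡ᵇ 0)
isZeroP {F = F} f = castP (λ a → ifz-isZero (F a)) (ifzP f (constP 1) (constP 0))
  where
  ifz-isZero : ∀ n → ifz n 1 0 ≡ boolToℕ (n ≡ᵇ 0)
  ifz-isZero zero = refl
  ifz-isZero (suc n) = refl

iterP : {G : El (ℕᵗ ⊗ ℕᵗ ⊗ ℕᵗ) → ℕ} → ∀ z → Prog (ℕᵗ ⊗ ℕᵗ ⊗ ℕᵗ) G →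
        Prog ℕᵗ (primRec (λ _ → z) G 0)
iterP z g = compP (0 ,_) (precP (constP z) g) (pairP (constP 0) selfP)

predP : Prog ℕᵗ pred
predP = castP previous (iterP 0 (compP proj₂ fstP sndP))
  where
  previous : ∀ n → primRec (λ _ → 0) (λ u → proj₁ (proj₂ u)) 0 n ≡ pred n
  previous zero = refl
  previous (suc n) = refl

monusP : Prog (ℕᵗ ⊗ ℕᵗ) (λ t → proj₁ t ∸ proj₂ t)
monusP = castP (λ t → iterated-pred (proj₁ t) (proj₂ t)) (precP selfP (app₁ predP (compP proj₂ sndP sndP)))
  where
  iterated-pred : ∀ a n → primRec (λ x → x) (λ u → pred (proj₂ (proj₂ u))) a n ≡ a ∸ n
  iterated-pred a zero = refl
  iterated-pred a (suc n) rewrite iterated-pred a n = pred[m∸n]≡m∸[1+n] a n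

eqP : ProgB (ℕᵗ ⊗ ℕᵗ) (λ t → proj₁ t ≡ᵇ proj₂ t)
eqP = castP (λ t → cong boolToℕ (∸-both-zero (proj₁ t) (proj₂ t)))
            (andP (isZeroP monusP) (isZeroP (app₂ monusP sndP fstP)))
  where
  ∸-both-zero : ∀ a b → (((a ∸ b) ≡ᵇ 0) ∧ ((b ∸ a) ≡ᵇ 0)) ≡ (a ≡ᵇ b)
  ∸-both-zero zero zero = refl
  ∸-both-zero zero (suc b) = refl
  ∸-both-zero (suc a) zero = refl
  ∸-both-zero (suc a) (suc b) = ∸-both-zero a b

anyBelow : (ℕ → Bool) → ℕ → Bool
anyBelow q zero = false
anyBelow q (suc n) = q n ∨ anyBelow q n

allBelow : (ℕ → Bool) → ℕ → Bool
allBelow q zero = true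
allBelow q (suc n) = q n ∧ allBelow q n

anyBelowP : {Q : El (σ ⊗ ℕᵗ) → Bool} → ProgB (σ ⊗ ℕᵗ) Q →
            ProgB (σ ⊗ ℕᵗ) (λ t → anyBelow (λ k → Q (proj₁ t , k)) (proj₂ t))
anyBelowP {Q = Q} q = castP (λ t → accumulates (proj₁ t) (proj₂ t))
  (precP (constP 0) (ifP (compP (λ u → proj₁ u , proj₁ (proj₂ u)) q (pairP fstP (compP proj₂ fstP sndP)))
                         (constP 1) (compP proj₂ sndP sndP)))
  where
  accumulates : ∀ a n →
    primRec (λ _ → 0) (λ u → if Q (proj₁ u , proj₁ (proj₂ u)) then 1 else proj₂ (proj₂ u)) a n
    ≡ boolToℕ (anyBelow (λ k → Q (a , k)) n)
  accumulates a zero = refl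
  accumulates a (suc n) with Q (a , n)
  ... | true = refl
  ... | false = accumulates a n

allBelowP : {Q : El (σ ⊗ ℕᵗ) → Bool} → ProgB (σ ⊗ ℕᵗ) Q →
            ProgB (σ ⊗ ℕᵗ) (λ t → allBelow (λ k → Q (proj₁ t , k)) (proj₂ t))
allBelowP {Q = Q} q = castP (λ t → accumulates (proj₁ t) (proj₂ t))
  (precP (constP 1) (ifP (compP (λ u → proj₁ u , proj₁ (proj₂ u)) q (pairP fstP (compP proj₂ fstP sndP)))
                         (compP proj₂ sndP sndP) (constP 0)))
  where
  accumulates : ∀ a n →
    primRec (λ _ → 1) (λ u → if Q (proj₁ u , proj₁ (proj₂ u)) then proj₂ (proj₂ u) else 0) a n
    ≡ boolToℕ (allBelow (λ k → Q (a , k)) n)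
  accumulates a zero = refl
  accumulates a (suc n) with Q (a , n)
  ... | true = accumulates a n
  ... | false = refl

anyBelow⁺ : ∀ q {n k} → k < n → T (q k) → T (anyBelow q n)
anyBelow⁺ q {suc n} k<1+n qk with m<1+n⇒m<n∨m≡n k<1+n
... | inj₁ k<n = Equivalence.from T-∨ (inj₂ (anyBelow⁺ q k<n qk))
... | inj₂ refl = Equivalence.from T-∨ (inj₁ qk)

anyBelow⁻ : ∀ q n → T (anyBelow q n) → ∃[ k ] k < n × T (q k)
anyBelow⁻ q (suc n) any with Equivalence.to T-∨ any
... | inj₁ qn = n , ≤-refl , qn
... | inj₂ any′ with anyBelow⁻ q n any′
... | k , k<n , qk = k , m<n⇒m<1+n k<n , qk

allBelow⁺ : ∀ q n → (∀ k → k < n → T (q k)) → T (allBelow q n)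
allBelow⁺ q zero all = _
allBelow⁺ q (suc n) all =
  Equivalence.from T-∧ (all n ≤-refl , allBelow⁺ q n (λ k k<n → all k (m<n⇒m<1+n k<n)))

allBelow⁻ : ∀ q {n} → T (allBelow q n) → ∀ k → k < n → T (q k)
allBelow⁻ q {suc n} all k k<1+n with Equivalence.to T-∧ all | m<1+n⇒m<n∨m≡n k<1+n
... | _ , all′ | inj₁ k<n = allBelow⁻ q all′ k k<n
... | qn , _ | inj₂ refl = qn

code-surjective : ∀ τ n → ∃[ a ] code τ a ≡ n
code-surjective ℕᵗ n = n , refl
code-surjective (σ ⊗ τ) n with code-surjective σ (π₁ n) | code-surjective τ (π₂ n)
... | a , code-a | b , code-b = (a , b) , trans (cong₂ ⟨_,_⟩ code-a code-b) (pair-π n)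

Computes : ∀ τ → ℕ → (El τ → ℕ) → Set
Computes τ i F = ∀ a → i ⟦ code τ a ⟧↓ F a

Computes-total : ∀ i {F : El τ → ℕ} → Computes τ i F → Total i
Computes-total {τ} i computes n with code-surjective τ n
... | a , code-a = _ , subst (λ n → i ⟦ n ⟧↓ _) code-a (computes a)

encode-constCodeP : Prog ℕᵗ (λ e → encode (constCode e))
encode-constCodeP = castP iterated-encoding
  (iterP ⟨ 0 , 0 ⟩ (pairP (constP 5) (pairP (constP ⟨ 1 , 0 ⟩) (compP proj₂ sndP sndP))))
  where
  iterated-encoding : ∀ e → primRec (λ _ → ⟨ 0 , 0 ⟩) (λ u → ⟨ 5 , ⟨ ⟨ 1 , 0 ⟩ , proj₂ (proj₂ u) ⟩ ⟩) 0 e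
                            ≡ encode (constCode e)
  iterated-encoding zero = refl
  iterated-encoding (suc e) = cong (λ n → ⟨ 5 , ⟨ ⟨ 1 , 0 ⟩ , n ⟩ ⟩) (iterated-encoding e)

-- Opaque, so that the (astronomically large) numbers encoding programs are never computed.
opaque
  index : {F : El τ → ℕ} → Prog τ F → ℕ
  index (c , _) = encode c

  index-computes : {F : El τ → ℕ} (p : Prog τ F) → Computes τ (index p) F
  index-computes {τ} (c , computes) a = subst (λ d → d ⊢ code τ a ⇓ _) (sym (decode-encode c)) (computes a)

  -- The s-m-n theorem: a ↦ F (e , a) is computed by cComp c (cPair (constCode e) cId).
  smn : {F : El (ℕᵗ ⊗ τ) → ℕ} → Prog (ℕᵗ ⊗ τ) F →
        Σ[ g ∈ (ℕ → ℕ) ] Prog ℕᵗ g × (∀ e → Computes τ (g e) (λ a → F (e , a)))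
  smn {τ} {F} (c , computes) = encode ∘ specialise , specialiseP , specialise-computes
    where
    specialise : ℕ → Code
    specialise e = cComp c (cPair (constCode e) cId)
    specialiseP : Prog ℕᵗ (encode ∘ specialise)
    specialiseP = pairP (constP 5) (pairP (constP (encode c))
                    (pairP (constP 6) (pairP encode-constCodeP (constP (encode cId)))))
    specialise-computes : ∀ e a → encode (specialise e) ⟦ code τ a ⟧↓ F (e , a)
    specialise-computes e a = subst (λ d → d ⊢ code τ a ⇓ F (e , a)) (sym (decode-encode (specialise e)))
                                (⇓-cComp (⇓-cPair (constCode-⇓ e _) (1 , refl)) (computes (e , a)))

prog-computable : {F : ℕ → ℕ} → Prog ℕᵗ F → Computable F
prog-computable p = index p , index-computes p

-- An entry ⟨ claim , hint ⟩ of a certificate is an instance of a rule of the big-step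
-- semantics; has tells which claims occur further down the list. The claim
-- evalClaim c x y says that decode c maps x to y, and searchClaim c x y (the premise of a
-- μ-step) that decode c maps each ⟨ x , j ⟩ with j < y to a nonzero value. The hint is the
-- intermediate value a rule needs: the middle value of a composition, the previous value of
-- a recursion, the nonzero value at y - 1. Rules are selected by the tag π₁ c of the code, as
-- in decodeStep.
evalClaim searchClaim : ℕ → ℕ → ℕ → ℕ
evalClaim c x y = ⟨ 0 , ⟨ c , ⟨ x , y ⟩ ⟩ ⟩
searchClaim c x y = ⟨ 1 , ⟨ c , ⟨ x , y ⟩ ⟩ ⟩

precRule : (ℕ → Bool) → (r c a n y h : ℕ) → Bool
precRule has r c a n y h =
  if n ≡ᵇ 0 then has (evalClaim (π₁ r) a y)
  else has (evalClaim c ⟨ a , pred n ⟩ h) ∧ has (evalClaim (π₂ r) ⟨ a , ⟨ pred n , h ⟩ ⟩ y)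

evalRule : (ℕ → Bool) → (tag r c x y h : ℕ) → Bool
evalRule has tag r c x y h =
  if tag ≡ᵇ 0 then y ≡ᵇ 0
  else if tag ≡ᵇ 1 then y ≡ᵇ suc x
  else if tag ≡ᵇ 2 then y ≡ᵇ x
  else if tag ≡ᵇ 3 then y ≡ᵇ π₁ x
  else if tag ≡ᵇ 4 then y ≡ᵇ π₂ x
  else if tag ≡ᵇ 5 then has (evalClaim (π₂ r) x h) ∧ has (evalClaim (π₁ r) h y)
  else if tag ≡ᵇ 6 then has (evalClaim (π₁ r) x (π₁ y)) ∧ has (evalClaim (π₂ r) x (π₂ y))
  else if tag ≡ᵇ 7 then precRule has r c (π₁ x) (π₂ x) y h
  else has (searchClaim r x y) ∧ has (evalClaim r ⟨ x , y ⟩ 0)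

searchRule : (ℕ → Bool) → (c x y h : ℕ) → Bool
searchRule has c x y h =
  if y ≡ᵇ 0 then true
  else not (h ≡ᵇ 0) ∧ (has (searchClaim c x (pred y)) ∧ has (evalClaim c ⟨ x , pred y ⟩ h))

rule : (ℕ → Bool) → (kind c x y h : ℕ) → Bool
rule has kind c x y h = if kind ≡ᵇ 0 then evalRule has (π₁ c) (π₂ c) c x y h else searchRule has c x y h

kindOf codeOf inputOf outputOf hintOf : ℕ → ℕ
kindOf e = π₁ (π₁ e)
codeOf e = π₁ (π₂ (π₁ e))
inputOf e = π₁ (π₂ (π₂ (π₁ e)))
outputOf e = π₂ (π₂ (π₂ (π₁ e)))
hintOf e = π₂ e

justified : (ℕ → Bool) → ℕ → Bool
justified has e = rule has (kindOf e) (codeOf e) (inputOf e) (outputOf e) (hintOf e)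

justified-entry : ∀ has e k c x y → π₁ e ≡ ⟨ k , ⟨ c , ⟨ x , y ⟩ ⟩ ⟩ →
                  justified has e ≡ rule has k c x y (π₂ e)
justified-entry has e k c x y eq
  rewrite eq | unpair-pair k ⟨ c , ⟨ x , y ⟩ ⟩ | unpair-pair c ⟨ x , y ⟩ | unpair-pair x y = refl

_⊆ᵇ_ : (ℕ → Bool) → (ℕ → Bool) → Set
has ⊆ᵇ has′ = ∀ X → T (has X) → T (has′ X)

T-∧-map : ∀ {a a′ b b′} → (T a → T a′) → (T b → T b′) → T (a ∧ b) → T (a′ ∧ b′)
T-∧-map f g ab with Equivalence.to T-∧ ab
... | a , b = Equivalence.from T-∧ (f a , g b)

T-if-map : ∀ b {p p′ q q′} → (T p → T p′) → (T q → T q′) →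
           T (if b then p else q) → T (if b then p′ else q′)
T-if-map true f g = f
T-if-map false f g = g

T-not⁻ : ∀ b → T (not b) → ¬ T b
T-not⁻ true ()

T-not⁺ : ∀ b → ¬ T b → T (not b)
T-not⁺ true ¬b = ¬b _
T-not⁺ false _ = _

evalRule-mono : ∀ {has has′} → has ⊆ᵇ has′ → ∀ tag r c x y h →
                T (evalRule has tag r c x y h) → T (evalRule has′ tag r c x y h)
evalRule-mono ⊆ 0 r c x y h = id
evalRule-mono ⊆ 1 r c x y h = id
evalRule-mono ⊆ 2 r c x y h = id
evalRule-mono ⊆ 3 r c x y h = id
evalRule-mono ⊆ 4 r c x y h = id
evalRule-mono ⊆ 5 r c x y h = T-∧-map (⊆ _) (⊆ _)
evalRule-mono ⊆ 6 r c x y h = T-∧-map (⊆ _) (⊆ _)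
evalRule-mono ⊆ 7 r c x y h = T-if-map (π₂ x ≡ᵇ 0) (⊆ _) (T-∧-map (⊆ _) (⊆ _))
evalRule-mono ⊆ (suc (suc (suc (suc (suc (suc (suc (suc _)))))))) r c x y h = T-∧-map (⊆ _) (⊆ _)

searchRule-mono : ∀ {has has′} → has ⊆ᵇ has′ → ∀ c x y h →
                  T (searchRule has c x y h) → T (searchRule has′ c x y h)
searchRule-mono ⊆ c x zero h = id
searchRule-mono ⊆ c x (suc y) h = T-∧-map {a = not (h ≡ᵇ 0)} id (T-∧-map (⊆ _) (⊆ _))

rule-mono : ∀ {has has′} → has ⊆ᵇ has′ → ∀ kind c x y h →
            T (rule has kind c x y h) → T (rule has′ kind c x y h)
rule-mono ⊆ kind c x y h =
  T-if-map (kind ≡ᵇ 0) (evalRule-mono ⊆ (π₁ c) (π₂ c) c x y h) (searchRule-mono ⊆ c x y h)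

justified-mono : ∀ {has has′} → has ⊆ᵇ has′ → ∀ e → T (justified has e) → T (justified has′ e)
justified-mono ⊆ e = rule-mono ⊆ (kindOf e) (codeOf e) (inputOf e) (outputOf e) (hintOf e)

hd tl : ℕ → ℕ
hd L = π₁ (pred L)
tl L = π₂ (pred L)

drop : ℕ → ℕ → ℕ
drop zero L = L
drop (suc k) L = tl (drop k L)

memAt : ℕ → ℕ → Bool
memAt X S = not (S ≡ᵇ 0) ∧ (π₁ (hd S) ≡ᵇ X)

-- A list is shorter than its code, so scanning the first L suffixes of L suffices.
mem : ℕ → ℕ → Bool
mem L X = anyBelow (λ k → memAt X (drop k L)) L

validAt : ℕ → Bool
validAt S = (S ≡ᵇ 0) ∨ justified (mem (tl S)) (hd S)

valid : ℕ → Bool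
valid L = allBelow (λ k → validAt (drop k L)) L

enc : List ℕ → ℕ
enc [] = 0
enc (e ∷ es) = suc ⟨ e , enc es ⟩

hd-enc : ∀ e es → hd (enc (e ∷ es)) ≡ e
hd-enc e es = π₁-pair e (enc es)

tl-enc : ∀ e es → tl (enc (e ∷ es)) ≡ enc es
tl-enc e es = π₂-pair e (enc es)

suc-<-enc : ∀ {k} e es → k < enc es → suc k < enc (e ∷ es)
suc-<-enc e es k<n = s≤s (≤-trans k<n (≤-trans (m≤n+m (enc es) e) (+≤pair e (enc es))))

drop-suc : ∀ k L → drop (suc k) L ≡ drop k (tl L)
drop-suc zero L = refl
drop-suc (suc k) L = cong tl (drop-suc k L)

drop-enc : ∀ k e es → drop (suc k) (enc (e ∷ es)) ≡ drop k (enc es)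
drop-enc k e es = trans (drop-suc k _) (cong (drop k) (tl-enc e es))

drop-0 : ∀ k → drop k 0 ≡ 0
drop-0 zero = refl
drop-0 (suc k) = cong tl (drop-0 k)

enc-surjective : ∀ L → ∃[ es ] enc es ≡ L
enc-surjective L = decodeList L L ≤-refl
  where
  decodeList : ∀ fuel L → L ≤ fuel → ∃[ es ] enc es ≡ L
  decodeList _ zero _ = [] , refl
  decodeList (suc fuel) (suc n) (s≤s n≤fuel) with decodeList fuel (π₂ n) (≤-trans (π₂≤ n) n≤fuel)
  ... | es , enc-es = π₁ n ∷ es , cong suc (trans (cong ⟨ π₁ n ,_⟩ enc-es) (pair-π n))

infix 4 _∈claims_

_∈claims_ : ℕ → List ℕ → Set
X ∈claims es = Any (λ e → π₁ e ≡ X) es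

data Valid : List ℕ → Set where
  [] : Valid []
  _∷_ : ∀ {e es} → T (justified (mem (enc es)) e) → Valid es → Valid (e ∷ es)

mem⁻ : ∀ es X → T (mem (enc es) X) → X ∈claims es
mem⁻ es X found with anyBelow⁻ _ (enc es) found
... | k , _ , at-k = at k es at-k
  where
  at : ∀ k es → T (memAt X (drop k (enc es))) → X ∈claims es
  at k [] p rewrite drop-0 k = ⊥-elim p
  at zero (e ∷ es) p = here (trans (cong π₁ (sym (hd-enc e es))) (≡ᵇ⇒≡ _ _ p))
  at (suc k) (e ∷ es) p rewrite drop-enc k e es = there (at k es p)

mem⁺ : ∀ es X → X ∈claims es → T (mem (enc es) X)
mem⁺ es X X∈ with position es X∈
  where
  position : ∀ es → X ∈claims es → ∃[ k ] k < enc es × T (memAt X (drop k (enc es)))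
  position (e ∷ es) (here refl) = 0 , s≤s z≤n , ≡⇒≡ᵇ _ _ (cong π₁ (hd-enc e es))
  position (e ∷ es) (there X∈) with position es X∈
  ... | k , k<n , at-k rewrite sym (drop-enc k e es) = suc k , suc-<-enc e es k<n , at-k
... | k , k<n , at-k = anyBelow⁺ _ k<n at-k

valid⁺ : ∀ {es} → Valid es → T (valid (enc es))
valid⁺ {es} v = allBelow⁺ _ (enc es) (λ k _ → at k v)
  where
  at : ∀ k {es} → Valid es → T (validAt (drop k (enc es)))
  at k [] rewrite drop-0 k = _
  at zero {e ∷ es} (j ∷ _) rewrite hd-enc e es | tl-enc e es = j
  at (suc k) {e ∷ es} (_ ∷ v) rewrite drop-enc k e es = at k v

valid⁻ : ∀ es → T (valid (enc es)) → Valid es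
valid⁻ es v = from-positions es (allBelow⁻ _ v)
  where
  from-positions : ∀ es → (∀ k → k < enc es → T (validAt (drop k (enc es)))) → Valid es
  from-positions [] _ = []
  from-positions (e ∷ es) at = head ∷ from-positions es rest
    where
    head : T (justified (mem (enc es)) e)
    head = subst₂ (λ t h → T (justified (mem t) h)) (tl-enc e es) (hd-enc e es) (at 0 (s≤s z≤n))
    rest : ∀ k → k < enc es → T (validAt (drop k (enc es)))
    rest k k<n = subst (T ∘ validAt) (drop-enc k e es) (at (suc k) (suc-<-enc e es k<n))

record Sound (has : ℕ → Bool) : Set where
  field
    evalClaim-sound : ∀ c x y → T (has (evalClaim c x y)) → decode c ⊢ x ⇓ y
    searchClaim-sound : ∀ c x y → T (has (searchClaim c x y)) → NonzeroBelow (decode c) x y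

open Sound

precRule-sound : ∀ {has} → Sound has → ∀ r c a n y h → decode c ≡ cPrec (decode (π₁ r)) (decode (π₂ r)) →
                 T (precRule has r c a n y h) → cPrec (decode (π₁ r)) (decode (π₂ r)) ⊢ ⟨ a , n ⟩ ⇓ y
precRule-sound S r c a zero y h dc base = ⇓-cPrec-zero (evalClaim-sound S (π₁ r) a y base)
precRule-sound S r c a (suc n) y h dc p with Equivalence.to T-∧ p
... | previous , step =
  ⇓-cPrec-suc {a = a} (subst (λ d → d ⊢ ⟨ a , n ⟩ ⇓ h) dc (evalClaim-sound S c ⟨ a , n ⟩ h previous))
                      (evalClaim-sound S (π₂ r) ⟨ a , ⟨ n , h ⟩ ⟩ y step)

evalRule-sound : ∀ {has} → Sound has → ∀ tag r c x y h → decode c ≡ decodeStep decode (tag , r) →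
                 T (evalRule has tag r c x y h) → decodeStep decode (tag , r) ⊢ x ⇓ y
evalRule-sound S 0 r c x y h dc p rewrite ≡ᵇ⇒≡ y 0 p = 1 , refl
evalRule-sound S 1 r c x y h dc p rewrite ≡ᵇ⇒≡ y (suc x) p = 1 , refl
evalRule-sound S 2 r c x y h dc p rewrite ≡ᵇ⇒≡ y x p = 1 , refl
evalRule-sound S 3 r c x y h dc p rewrite ≡ᵇ⇒≡ y (π₁ x) p = 1 , refl
evalRule-sound S 4 r c x y h dc p rewrite ≡ᵇ⇒≡ y (π₂ x) p = 1 , refl
evalRule-sound S 5 r c x y h dc p with Equivalence.to T-∧ p
... | inner , outer = ⇓-cComp (evalClaim-sound S (π₂ r) x h inner) (evalClaim-sound S (π₁ r) h y outer)
evalRule-sound S 6 r c x y h dc p with Equivalence.to T-∧ p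
... | left , right =
  subst (_ ⊢ x ⇓_) (pair-π y)
        (⇓-cPair (evalClaim-sound S (π₁ r) x (π₁ y) left) (evalClaim-sound S (π₂ r) x (π₂ y) right))
evalRule-sound S 7 r c x y h dc p =
  subst (λ x → _ ⊢ x ⇓ y) (pair-π x) (precRule-sound S r c (π₁ x) (π₂ x) y h dc p)
evalRule-sound S (suc (suc (suc (suc (suc (suc (suc (suc _)))))))) r c x y h dc p with Equivalence.to T-∧ p
... | below , at-y = ⇓-cMu (searchClaim-sound S r x y below) (evalClaim-sound S r ⟨ x , y ⟩ 0 at-y)

searchRule-sound : ∀ {has} → Sound has → ∀ c x y h → T (searchRule has c x y h) → NonzeroBelow (decode c) x y
searchRule-sound S c x (suc y) (suc v) p j j<1+y with Equivalence.to T-∧ p | m<1+n⇒m<n∨m≡n j<1+y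
... | below , _ | inj₁ j<y = searchClaim-sound S c x y below j j<y
... | _ , at-y | inj₂ refl = v , evalClaim-sound S c ⟨ x , y ⟩ (suc v) at-y

valid-sound : ∀ {es} → Valid es → Sound (mem (enc es))
valid-sound [] = record { evalClaim-sound = λ _ _ _ () ; searchClaim-sound = λ _ _ _ () }
valid-sound {e ∷ es} (j ∷ v) = record { evalClaim-sound = eval-case ; searchClaim-sound = search-case }
  where
  IH : Sound (mem (enc es))
  IH = valid-sound v
  eval-case : ∀ c x y → T (mem (enc (e ∷ es)) (evalClaim c x y)) → decode c ⊢ x ⇓ y
  eval-case c x y m with mem⁻ (e ∷ es) (evalClaim c x y) m
  ... | here eq = subst (λ d → d ⊢ x ⇓ y) (sym (decode-unfold c))
                    (evalRule-sound IH (π₁ c) (π₂ c) c x y (π₂ e) (decode-unfold c)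
                                    (subst T (justified-entry (mem (enc es)) e 0 c x y eq) j))
  ... | there m′ = evalClaim-sound IH c x y (mem⁺ es _ m′)
  search-case : ∀ c x y → T (mem (enc (e ∷ es)) (searchClaim c x y)) → NonzeroBelow (decode c) x y
  search-case c x y m with mem⁻ (e ∷ es) (searchClaim c x y) m
  ... | here eq = searchRule-sound IH c x y (π₂ e) (subst T (justified-entry (mem (enc es)) e 1 c x y eq) j)
  ... | there m′ = searchClaim-sound IH c x y (mem⁺ es _ m′)

Certificate : ℕ → Set
Certificate X = Σ[ es ∈ List ℕ ] Valid es × X ∈claims es

mem-++ˡ : ∀ es₁ es₂ → mem (enc es₁) ⊆ᵇ mem (enc (es₁ ++ es₂))
mem-++ˡ es₁ es₂ X m = mem⁺ (es₁ ++ es₂) X (++⁺ˡ (mem⁻ es₁ X m))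

Valid-++ : ∀ {es₁ es₂} → Valid es₁ → Valid es₂ → Valid (es₁ ++ es₂)
Valid-++ [] v₂ = v₂
Valid-++ {e ∷ es₁} {es₂} (j ∷ v₁) v₂ = justified-mono (mem-++ˡ es₁ es₂) e j ∷ Valid-++ v₁ v₂

merge : ∀ {A B} → Certificate A → Certificate B →
        Σ[ es ∈ List ℕ ] Valid es × T (mem (enc es) A) × T (mem (enc es) B)
merge {A} {B} (es₁ , v₁ , A∈) (es₂ , v₂ , B∈) =
  es₁ ++ es₂ , Valid-++ v₁ v₂ , mem⁺ (es₁ ++ es₂) A (++⁺ˡ A∈) , mem⁺ (es₁ ++ es₂) B (++⁺ʳ es₁ B∈)

conclude : ∀ k c x y h {es} → Valid es → T (rule (mem (enc es)) k c x y h) →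
           Certificate ⟨ k , ⟨ c , ⟨ x , y ⟩ ⟩ ⟩
conclude k c x y h {es} v r = entry ∷ es , subst T (sym justified-here) r ∷ v , here (π₁-pair claim h)
  where
  claim = ⟨ k , ⟨ c , ⟨ x , y ⟩ ⟩ ⟩
  entry = ⟨ claim , h ⟩
  justified-here : justified (mem (enc es)) entry ≡ rule (mem (enc es)) k c x y h
  justified-here = trans (justified-entry (mem (enc es)) entry k c x y (π₁-pair claim h))
                         (cong (rule (mem (enc es)) k c x y) (π₂-pair claim h))

conclude-eval : ∀ {tag} c x y h {es} → π₁ c ≡ tag → Valid es → T (evalRule (mem (enc es)) tag (π₂ c) c x y h) →
                Certificate (evalClaim c x y)
conclude-eval c x y h refl = conclude 0 c x y h

precRule-at : ∀ has r c a n y h → T (precRule has r c a n y h) → T (evalRule has 7 r c ⟨ a , n ⟩ y h)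
precRule-at has r c a n y h =
  subst₂ (λ a n → T (precRule has r c a n y h)) (sym (π₁-pair a n)) (sym (π₂-pair a n))

mutual
  certify : ∀ s c x {y} → eval s (decode c) x ≡ just y → Certificate (evalClaim c x y)
  certify (suc s) c x ev =
    certify-step s c (π₁ c) refl x (subst (λ d → eval (suc s) d x ≡ just _) (decode-unfold c) ev)

  certify-step : ∀ s c tag → π₁ c ≡ tag → ∀ x {y} → eval (suc s) (decodeStep decode (tag , π₂ c)) x ≡ just y →
                 Certificate (evalClaim c x y)
  certify-step s c 0 tag≡ x refl = conclude-eval c x 0 0 tag≡ [] _
  certify-step s c 1 tag≡ x refl = conclude-eval c x (suc x) 0 tag≡ [] (≡⇒≡ᵇ x x refl)
  certify-step s c 2 tag≡ x refl = conclude-eval c x x 0 tag≡ [] (≡⇒≡ᵇ x x refl)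
  certify-step s c 3 tag≡ x refl = conclude-eval c x (π₁ x) 0 tag≡ [] (≡⇒≡ᵇ (π₁ x) (π₁ x) refl)
  certify-step s c 4 tag≡ x refl = conclude-eval c x (π₂ x) 0 tag≡ [] (≡⇒≡ᵇ (π₂ x) (π₂ x) refl)
  certify-step s c 5 tag≡ x ev with >>=-just⁻¹ {eval s (decode (π₂ (π₂ c))) x} ev
  ... | z , inner , outer with merge (certify s (π₂ (π₂ c)) x inner) (certify s (π₁ (π₂ c)) z outer)
  ... | es , v , m₁ , m₂ = conclude-eval c x _ z tag≡ v (Equivalence.from T-∧ (m₁ , m₂))
  certify-step s c 6 tag≡ x ev with >>=-just⁻¹ {eval s (decode (π₁ (π₂ c))) x} ev
  ... | a , left , rest with >>=-just⁻¹ {eval s (decode (π₂ (π₂ c))) x} rest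
  ... | b , right , refl with merge (certify s (π₁ (π₂ c)) x left) (certify s (π₂ (π₂ c)) x right)
  ... | es , v , m₁ , m₂ = conclude-eval c x ⟨ a , b ⟩ 0 tag≡ v (Equivalence.from T-∧
          ( subst (λ a → T (mem (enc es) (evalClaim (π₁ (π₂ c)) x a))) (sym (π₁-pair a b)) m₁
          , subst (λ b → T (mem (enc es) (evalClaim (π₂ (π₂ c)) x b))) (sym (π₂-pair a b)) m₂))
  certify-step s c 7 tag≡ x ev =
    subst (λ x → Certificate (evalClaim c x _)) (pair-π x)
      (certify-prec s c tag≡ x (π₂ x) (trans (sym (eval-cPrec s _ _ x)) ev))
  certify-step s c (suc (suc (suc (suc (suc (suc (suc (suc _)))))))) tag≡ x ev
    with evalSearch⁻¹ s (decode (π₂ c)) x s 0 ev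
  ... | _ , nonzero , zero-at-y
    with merge (certify-search s (π₂ c) x _ (λ j → nonzero j z≤n)) (certify s (π₂ c) ⟨ x , _ ⟩ zero-at-y)
  ... | es , v , m₁ , m₂ = conclude-eval c x _ 0 tag≡ v (Equivalence.from T-∧ (m₁ , m₂))

  certify-prec : ∀ s c → π₁ c ≡ 7 → ∀ x n {y} →
                 evalRec s (decode (π₁ (π₂ c))) (decode (π₂ (π₂ c))) x n ≡ just y →
                 Certificate (evalClaim c ⟨ π₁ x , n ⟩ y)
  certify-prec s c tag≡ x zero {y} ev with certify s (π₁ (π₂ c)) (π₁ x) ev
  ... | es , v , base = conclude-eval c ⟨ π₁ x , 0 ⟩ y 0 tag≡ v
                          (precRule-at (mem (enc es)) (π₂ c) c (π₁ x) 0 y 0 (mem⁺ es _ base))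
  certify-prec s c tag≡ x (suc n) {y} ev with >>=-just⁻¹ {evalRec s _ _ x n} ev
  ... | h , previous , step with merge (certify-prec s c tag≡ x n previous) (certify s (π₂ (π₂ c)) _ step)
  ... | es , v , m₁ , m₂ = conclude-eval c ⟨ π₁ x , suc n ⟩ y h tag≡ v
                             (precRule-at (mem (enc es)) (π₂ c) c (π₁ x) (suc n) y h
                                          (Equivalence.from T-∧ (m₁ , m₂)))

  certify-search : ∀ s r x j → (∀ i → i < j → ∃[ v ] eval s (decode r) ⟨ x , i ⟩ ≡ just (suc v)) →
                   Certificate (searchClaim r x j)
  certify-search s r x zero _ = conclude 1 r x 0 0 [] _
  certify-search s r x (suc j) nonzero with nonzero j ≤-refl
  ... | v , at-j
    with merge (certify-search s r x j (λ i i<j → nonzero i (m<n⇒m<1+n i<j))) (certify s r ⟨ x , j ⟩ at-j)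
  ... | es , valid-es , m₁ , m₂ = conclude 1 r x (suc j) (suc v) valid-es (Equivalence.from T-∧ (m₁ , m₂))

eqN : {F G : El σ → ℕ} → Prog σ F → Prog σ G → ProgB σ (λ a → F a ≡ᵇ G a)
eqN = app₂ eqP

hdP : Prog ℕᵗ hd
hdP = app₁ π₁P predP

tlP : Prog ℕᵗ tl
tlP = app₁ π₂P predP

dropP : Prog (ℕᵗ ⊗ ℕᵗ) (λ t → drop (proj₂ t) (proj₁ t))
dropP = castP (λ t → iterated-tl (proj₁ t) (proj₂ t)) (precP selfP (app₁ tlP (compP proj₂ sndP sndP)))
  where
  iterated-tl : ∀ L k → primRec (λ L → L) (λ u → tl (proj₂ (proj₂ u))) L k ≡ drop k L
  iterated-tl L zero = refl
  iterated-tl L (suc k) = cong tl (iterated-tl L k)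

memAtP : ProgB (ℕᵗ ⊗ ℕᵗ) (λ t → memAt (proj₁ t) (proj₂ t))
memAtP = andP (notP (isZeroP sndP)) (eqN (app₁ π₁P (app₁ hdP sndP)) fstP)

memP : ProgB (ℕᵗ ⊗ ℕᵗ) (λ t → mem (proj₁ t) (proj₂ t))
memP = compP (λ t → t , proj₁ t)
             (anyBelowP (app₂ memAtP (compP proj₁ sndP fstP) (app₂ dropP (compP proj₁ fstP fstP) sndP)))
             (pairP selfP fstP)

justifiedP : ProgB (ℕᵗ ⊗ ℕᵗ) (λ t → justified (mem (proj₁ t)) (proj₂ t))
justifiedP =
  ifᵇP (isZeroP kind)
    (ifᵇP (tagIs 0) (isZeroP y)
    (ifᵇP (tagIs 1) (eqN y (app₁ sucP x))
    (ifᵇP (tagIs 2) (eqN y x)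
    (ifᵇP (tagIs 3) (eqN y (app₁ π₁P x))
    (ifᵇP (tagIs 4) (eqN y (app₁ π₂P x))
    (ifᵇP (tagIs 5) (andP (has (claimP 0 (app₁ π₂P r) x h)) (has (claimP 0 (app₁ π₁P r) h y)))
    (ifᵇP (tagIs 6) (andP (has (claimP 0 (app₁ π₁P r) x (app₁ π₁P y)))
                          (has (claimP 0 (app₁ π₂P r) x (app₁ π₂P y))))
    (ifᵇP (tagIs 7)
      (ifᵇP (isZeroP (app₁ π₂P x))
        (has (claimP 0 (app₁ π₁P r) (app₁ π₁P x) y))
        (andP (has (claimP 0 c (pairP (app₁ π₁P x) (app₁ predP (app₁ π₂P x))) h))
              (has (claimP 0 (app₁ π₂P r) (pairP (app₁ π₁P x) (pairP (app₁ predP (app₁ π₂P x)) h)) y))))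
    (andP (has (claimP 1 r x y)) (has (claimP 0 r (pairP x y) (constP 0))))))))))))
    (ifᵇP (isZeroP y) (constP 1)
      (andP (notP (isZeroP h))
            (andP (has (claimP 1 c x (app₁ predP y))) (has (claimP 0 c (pairP x (app₁ predP y)) h)))))
  where
  Env = ℕᵗ ⊗ ℕᵗ
  kind : Prog Env (λ t → kindOf (proj₂ t))
  kind = app₁ π₁P (app₁ π₁P sndP)
  c : Prog Env (λ t → codeOf (proj₂ t))
  c = app₁ π₁P (app₁ π₂P (app₁ π₁P sndP))
  x : Prog Env (λ t → inputOf (proj₂ t))
  x = app₁ π₁P (app₁ π₂P (app₁ π₂P (app₁ π₁P sndP)))
  y : Prog Env (λ t → outputOf (proj₂ t))
  y = app₁ π₂P (app₁ π₂P (app₁ π₂P (app₁ π₁P sndP)))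
  h : Prog Env (λ t → hintOf (proj₂ t))
  h = app₁ π₂P sndP
  r : Prog Env (λ t → π₂ (codeOf (proj₂ t)))
  r = app₁ π₂P c
  tagIs : ∀ n → ProgB Env (λ t → π₁ (codeOf (proj₂ t)) ≡ᵇ n)
  tagIs n = eqN (app₁ π₁P c) (constP n)
  claimP : {A B C : El Env → ℕ} → ∀ k → Prog Env A → Prog Env B → Prog Env C →
           Prog Env (λ t → ⟨ k , ⟨ A t , ⟨ B t , C t ⟩ ⟩ ⟩)
  claimP k a b d = pairP (constP k) (pairP a (pairP b d))
  has : {X : El Env → ℕ} → Prog Env X → ProgB Env (λ t → mem (proj₁ t) (X t))
  has = app₂ memP fstP

validAtP : ProgB ℕᵗ validAt
validAtP = orP (isZeroP selfP) (app₂ justifiedP tlP hdP)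

validP : ProgB ℕᵗ valid
validP = compP (λ L → L , L) (allBelowP (app₁ validAtP (app₂ dropP fstP sndP))) (pairP selfP selfP)

separates : (m x y i L : ℕ) → Bool
separates m x y i L = valid L ∧ (mem L (evalClaim m ⟨ i , x ⟩ 1) ∧ mem L (evalClaim m ⟨ i , y ⟩ 0))

separates-sound : ∀ m x y i L → T (separates m x y i L) → x ∈U[ m ] i × m ⟦ ⟨ i , y ⟩ ⟧↓ 0
separates-sound m x y i L p with enc-surjective L
... | es , refl with Equivalence.to T-∧ p
... | v , ms with Equivalence.to T-∧ ms | valid-sound (valid⁻ es v)
... | x-in , y-out | S = evalClaim-sound S m ⟨ i , x ⟩ 1 x-in , evalClaim-sound S m ⟨ i , y ⟩ 0 y-out

separates-complete : ∀ m x y i → x ∈U[ m ] i → m ⟦ ⟨ i , y ⟩ ⟧↓ 0 → ∃[ L ] T (separates m x y i L)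
separates-complete m x y i (s₁ , x-in) (s₂ , y-out)
  with merge (certify s₁ m ⟨ i , x ⟩ x-in) (certify s₂ m ⟨ i , y ⟩ y-out)
... | es , v , m₁ , m₂ = enc es , Equivalence.from T-∧ (valid⁺ v , Equivalence.from T-∧ (m₁ , m₂))

separatedBy : ℕ × ℕ × ℕ → Bool
separatedBy (e , a , b) = (π₁ a ≡ᵇ π₂ a) ∨ separates (π₁ e) (π₁ a) (π₂ a) (π₁ b) (π₂ b)

separatedByP : ProgB (ℕᵗ ⊗ ℕᵗ ⊗ ℕᵗ) separatedBy
separatedByP = orP (eqN x y) (andP (app₁ validP L) (andP (app₂ memP L (claim x 1)) (app₂ memP L (claim y 0))))
  where
  Env = ℕᵗ ⊗ ℕᵗ ⊗ ℕᵗ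
  a : Prog Env (λ t → proj₁ (proj₂ t))
  a = compP proj₂ fstP sndP
  b : Prog Env (λ t → proj₂ (proj₂ t))
  b = compP proj₂ sndP sndP
  x : Prog Env (λ t → π₁ (proj₁ (proj₂ t)))
  x = app₁ π₁P a
  y : Prog Env (λ t → π₂ (proj₁ (proj₂ t)))
  y = app₁ π₂P a
  L : Prog Env (λ t → π₂ (proj₂ (proj₂ t)))
  L = app₁ π₂P b
  claim : {X : El Env → ℕ} → Prog Env X → ∀ k →
          Prog Env (λ t → evalClaim (π₁ (proj₁ t)) ⟨ π₁ (proj₂ (proj₂ t)) , X t ⟩ k)
  claim p k = pairP (constP 0) (pairP (app₁ π₁P fstP) (pairP (pairP (app₁ π₁P b) p) (constP k)))

opaque
  matrix : ℕ
  matrix = index (notP separatedByP)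

  matrix-zero⁻ : ∀ e a b → matrix ⟦ ⟨ e , ⟨ a , b ⟩ ⟩ ⟧↓ 0 → T (separatedBy (e , a , b))
  matrix-zero⁻ e a b zero-at =
    not-0 (separatedBy (e , a , b)) (⇓-functional zero-at (index-computes (notP separatedByP) (e , a , b)))
    where
    not-0 : ∀ s → 0 ≡ boolToℕ (not s) → T s
    not-0 true _ = _

  matrix-zero⁺ : ∀ e a b → T (separatedBy (e , a , b)) → matrix ⟦ ⟨ e , ⟨ a , b ⟩ ⟩ ⟧↓ 0
  matrix-zero⁺ e a b sep =
    subst (matrix ⟦ ⟨ e , ⟨ a , b ⟩ ⟩ ⟧↓_) (not-0 (separatedBy (e , a , b)) sep)
          (index-computes (notP separatedByP) (e , a , b))
    where
    not-0 : ∀ s → T s → boolToℕ (not s) ≡ 0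
    not-0 true _ = refl


  matrix-total : Total matrix
  matrix-total = Computes-total matrix (index-computes (notP separatedByP))

basic-open : ∀ m i → IsOpen m (_∈U[ m ] i)
basic-open m i x x∈ = i , x∈ , λ _ y∈ → y∈

Separable : ℕ → Set₁
Separable e = Lift _ (∀ a → ∃[ b ] matrix ⟦ ⟨ e , ⟨ a , b ⟩ ⟩ ⟧↓ 0)

Separable-Π⁰₂ : IsΠ⁰₂ Separable
Separable-Π⁰₂ = matrix , matrix-total , λ e → mk⇔ lower lift

T1⇒Separable : ∀ e → T1-CSC e → Separable e
T1⇒Separable _ (m , n , refl , csc , t1) = lift separate
  where
  separate : ∀ a → ∃[ b ] matrix ⟦ ⟨ ⟨ m , n ⟩ , ⟨ a , b ⟩ ⟩ ⟧↓ 0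
  separate a with π₁ a ≟ π₂ a
  ... | yes x≡y = 0 , matrix-zero⁺ ⟨ m , n ⟩ a 0 (Equivalence.from T-∨ (inj₁ (≡⇒≡ᵇ _ _ x≡y)))
  ... | no x≢y with t1 (π₁ a) (π₂ a) x≢y
  ... | O , O-open , x∈O , y∉O with O-open (π₁ a) x∈O
  ... | i , x∈U , U⊆O with proj₁ (proj₂ csc) i (π₂ a)
  ... | inj₂ y∈U = ⊥-elim (y∉O (U⊆O (π₂ a) y∈U))
  ... | inj₁ y∉U with separates-complete m (π₁ a) (π₂ a) i x∈U y∉U
  ... | L , sep = ⟨ i , L ⟩ , matrix-zero⁺ ⟨ m , n ⟩ a ⟨ i , L ⟩ (Equivalence.from T-∨ (inj₂ sep′))
    where
    sep′ : T (separates (π₁ ⟨ m , n ⟩) (π₁ a) (π₂ a) (π₁ ⟨ i , L ⟩) (π₂ ⟨ i , L ⟩))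
    sep′ rewrite π₁-pair m n | π₁-pair i L | π₂-pair i L = sep

Separable⇒T1 : ∀ e → Separable e → T0-CSC e → T1-CSC e
Separable⇒T1 _ (lift separable) (m , n , refl , csc , _) = m , n , refl , csc , t1
  where
  t1 : IsT1 m
  t1 x y x≢y with separable ⟨ x , y ⟩
  ... | b , zero-at with Equivalence.to T-∨ (matrix-zero⁻ ⟨ m , n ⟩ ⟨ x , y ⟩ b zero-at)
  ... | inj₁ x≡ᵇy = ⊥-elim (x≢y (trans (sym (π₁-pair x y)) (trans (≡ᵇ⇒≡ _ _ x≡ᵇy) (π₂-pair x y))))
  ... | inj₂ sep with separates-sound m x y (π₁ b) (π₂ b) (subst T sep-at sep)
    where
    sep-at : separates (π₁ ⟨ m , n ⟩) (π₁ ⟨ x , y ⟩) (π₂ ⟨ x , y ⟩) (π₁ b) (π₂ b)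
             ≡ separates m x y (π₁ b) (π₂ b)
    sep-at rewrite π₁-pair m n | π₁-pair x y | π₂-pair x y = refl
  ... | x∈U , y-out = _∈U[ m ] π₁ b , basic-open m (π₁ b) , x∈U , λ y∈U → 0≢1 (⇓-functional y-out y∈U)
    where
    0≢1 : 0 ≢ 1
    0≢1 ()

T1⇒T0 : ∀ e → T1-CSC e → T0-CSC e
T1⇒T0 _ (m , n , e≡ , csc , t1) = m , n , e≡ , csc , t0
  where
  t0 : IsT0 m
  t0 x y x≢y with t1 x y x≢y
  ... | O , O-open , x∈O , y∉O = O , O-open , inj₁ (x∈O , y∉O)

T1-Π⁰₂-within-T0 : Π⁰₂-within T1-CSC T0-CSC
T1-Π⁰₂-within-T0 = Separable , Separable-Π⁰₂ , λ e →
  mk⇔ (λ t1 → T1⇒Separable e t1 , T1⇒T0 e t1) (λ (separable , t0) → Separable⇒T1 e separable t0)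

module Hardness (r : ℕ) (r-total : Total r) where

  R : ℕ → ℕ
  R z = proj₁ (r-total z)

  R-computes : ∀ z → r ⟦ z ⟧↓ R z
  R-computes z = proj₂ (r-total z)

  partner : ℕ → ℕ
  partner p = ⟨ π₁ p , 1 ⟩

  witnessed : (e t a : ℕ) → Bool
  witnessed e t a = not (t ≡ᵇ 0) ∧ (R ⟨ e , ⟨ a , pred t ⟩ ⟩ ≡ᵇ 0)

  -- U_⟨ t , p ⟩ is {p}, together with partner p = ⟨ a , 1 ⟩ when p = ⟨ a , 0 ⟩, unless
  -- t = b + 1 with R ⟨ e , ⟨ a , b ⟩ ⟩ = 0.
  member : (e i x : ℕ) → Bool
  member e i x =
    (x ≡ᵇ π₂ i) ∨ ((π₂ (π₂ i) ≡ᵇ 0) ∧ ((x ≡ᵇ partner (π₂ i)) ∧ not (witnessed e (π₁ i) (π₁ (π₂ i)))))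

  -- Basic sets around ⟨ a , 0 ⟩ lie inside {⟨ a , 0 ⟩ , ⟨ a , 1 ⟩}, so the partner decides
  -- which of U_i, U_j is the smaller.
  meet : (e i j x : ℕ) → ℕ
  meet e i j x = if π₂ x ≡ᵇ 0 then (if member e i (partner x) then j else i) else ⟨ 0 , x ⟩

  memberP : ProgB (ℕᵗ ⊗ ℕᵗ ⊗ ℕᵗ) (λ t → member (proj₁ t) (proj₁ (proj₂ t)) (proj₂ (proj₂ t)))
  memberP = orP (eqN x p) (andP (isZeroP (app₁ π₂P p)) (andP (eqN x (partnerP p)) (notP witnessedP)))
    where
    Env = ℕᵗ ⊗ ℕᵗ ⊗ ℕᵗ
    i : Prog Env (λ u → proj₁ (proj₂ u))
    i = compP proj₂ fstP sndP
    x : Prog Env (λ u → proj₂ (proj₂ u))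
    x = compP proj₂ sndP sndP
    t : Prog Env (λ u → π₁ (proj₁ (proj₂ u)))
    t = app₁ π₁P i
    p : Prog Env (λ u → π₂ (proj₁ (proj₂ u)))
    p = app₁ π₂P i
    partnerP : {P : El Env → ℕ} → Prog Env P → Prog Env (λ u → partner (P u))
    partnerP q = pairP (app₁ π₁P q) (constP 1)
    witnessedP : ProgB Env (λ u → witnessed (proj₁ u) (π₁ (proj₁ (proj₂ u))) (π₁ (π₂ (proj₁ (proj₂ u)))))
    witnessedP = andP (notP (isZeroP t))
                      (isZeroP (app₁ (decode r , R-computes) (pairP fstP (pairP (app₁ π₁P p) (app₁ predP t)))))

  meetP : Prog (ℕᵗ ⊗ ℕᵗ ⊗ ℕᵗ ⊗ ℕᵗ) (λ (e , i , j , x) → meet e i j x)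
  meetP = ifP (isZeroP (app₁ π₂P x))
              (ifP (compP (λ u → proj₁ u , proj₁ (proj₂ u) , partner (proj₂ (proj₂ (proj₂ u)))) memberP
                          (pairP fstP (pairP i (pairP (app₁ π₁P x) (constP 1)))))
                   j i)
              (pairP (constP 0) x)
    where
    Env = ℕᵗ ⊗ ℕᵗ ⊗ ℕᵗ ⊗ ℕᵗ
    i : Prog Env (λ u → proj₁ (proj₂ u))
    i = compP proj₂ fstP sndP
    j : Prog Env (λ u → proj₁ (proj₂ (proj₂ u)))
    j = compP (proj₂ ∘ proj₂) fstP (compP proj₂ sndP sndP)
    x : Prog Env (λ u → proj₂ (proj₂ (proj₂ u)))
    x = compP (proj₂ ∘ proj₂) sndP (compP proj₂ sndP sndP)

  π₂-partner : ∀ p → π₂ (partner p) ≡ 1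
  π₂-partner p = π₂-pair (π₁ p) 1

  member-centre : ∀ e t p → T (member e ⟨ t , p ⟩ p)
  member-centre e t p rewrite π₂-pair t p = Equivalence.from T-∨ (inj₁ (≡⇒≡ᵇ p p refl))

  member-cases : ∀ e t p y → T (member e ⟨ t , p ⟩ y) →
                 y ≡ p ⊎ (π₂ p ≡ 0 × y ≡ partner p × ¬ T (witnessed e t (π₁ p)))
  member-cases e t p y y∈ rewrite π₁-pair t p | π₂-pair t p with Equivalence.to T-∨ y∈
  ... | inj₁ y≡p = inj₁ (≡ᵇ⇒≡ y p y≡p)
  ... | inj₂ rest with Equivalence.to T-∧ rest
  ... | base , rest′ with Equivalence.to T-∧ rest′
  ... | y≡partner , unwitnessed =
    inj₂ (≡ᵇ⇒≡ _ 0 base , ≡ᵇ⇒≡ y _ y≡partner , T-not⁻ (witnessed e t (π₁ p)) unwitnessed)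

  member-partner : ∀ e t p → π₂ p ≡ 0 → ¬ T (witnessed e t (π₁ p)) → T (member e ⟨ t , p ⟩ (partner p))
  member-partner e t p base unwitnessed rewrite π₁-pair t p | π₂-pair t p | base =
    Equivalence.from T-∨ (inj₂ (Equivalence.from T-∧
      (≡⇒≡ᵇ (partner p) (partner p) refl , T-not⁺ (witnessed e t (π₁ p)) unwitnessed)))

  witnessed⁺ : ∀ e a b → r ⟦ ⟨ e , ⟨ a , b ⟩ ⟩ ⟧↓ 0 → T (witnessed e (suc b) a)
  witnessed⁺ e a b zero-at = ≡⇒≡ᵇ _ 0 (sym (⇓-functional zero-at (R-computes _)))

  witnessed⁻ : ∀ e t a → T (witnessed e t a) → ∃[ b ] r ⟦ ⟨ e , ⟨ a , b ⟩ ⟩ ⟧↓ 0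
  witnessed⁻ e (suc b) a w = b , subst (r ⟦ ⟨ e , ⟨ a , b ⟩ ⟩ ⟧↓_) (≡ᵇ⇒≡ _ 0 w) (R-computes _)

  meet-other : ∀ e i j x → π₂ x ≢ 0 → meet e i j x ≡ ⟨ 0 , x ⟩
  meet-other e i j x not-base with π₂ x
  ... | zero = ⊥-elim (not-base refl)
  ... | suc _ = refl

  meet-inner : ∀ e i j x → π₂ x ≡ 0 → T (member e i (partner x)) → meet e i j x ≡ j
  meet-inner e i j x eq partner∈ rewrite eq with member e i (partner x)
  ... | true = refl

  meet-outer : ∀ e i j x → π₂ x ≡ 0 → ¬ T (member e i (partner x)) → meet e i j x ≡ i
  meet-outer e i j x eq partner∉ rewrite eq with member e i (partner x)
  ... | true = ⊥-elim (partner∉ _)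
  ... | false = refl

  opaque
    basis : ℕ → ℕ
    basis = proj₁ (smn memberP)

    basis-computes : ∀ e → Computes (ℕᵗ ⊗ ℕᵗ) (basis e) (λ (i , x) → boolToℕ (member e i x))
    basis-computes = proj₂ (proj₂ (smn memberP))

    meets : ℕ → ℕ
    meets = proj₁ (smn meetP)

    meets-computes : ∀ e → Computes (ℕᵗ ⊗ ℕᵗ ⊗ ℕᵗ) (meets e) (λ (i , j , x) → meet e i j x)
    meets-computes = proj₂ (proj₂ (smn meetP))

    reduction-computable : Computable (λ e → ⟨ basis e , meets e ⟩)
    reduction-computable = prog-computable (pairP (proj₁ (proj₂ (smn memberP))) (proj₁ (proj₂ (smn meetP))))

  module Space (e : ℕ) where

    m n : ℕ
    m = basis e
    n = meets e

    member-computes : Computes (ℕᵗ ⊗ ℕᵗ) m (λ (i , x) → boolToℕ (member e i x))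
    member-computes = basis-computes e

    ∈U⁻ : ∀ i x → x ∈U[ m ] i → T (member e i x)
    ∈U⁻ i x x∈ = from-1 (member e i x) (⇓-functional x∈ (member-computes (i , x)))
      where
      from-1 : ∀ b → 1 ≡ boolToℕ b → T b
      from-1 true _ = _

    ∈U⁺ : ∀ i x → T (member e i x) → x ∈U[ m ] i
    ∈U⁺ i x x∈ = subst (m ⟦ ⟨ i , x ⟩ ⟧↓_) (to-1 (member e i x) x∈) (member-computes (i , x))
      where
      to-1 : ∀ b → T b → boolToℕ b ≡ 1
      to-1 true _ = refl

    centre∈ : ∀ t p → p ∈U[ m ] ⟨ t , p ⟩
    centre∈ t p = ∈U⁺ ⟨ t , p ⟩ p (member-centre e t p)

    ∈-cases : ∀ t p y → y ∈U[ m ] ⟨ t , p ⟩ →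
              y ≡ p ⊎ (π₂ p ≡ 0 × y ≡ partner p × ¬ T (witnessed e t (π₁ p)))
    ∈-cases t p y y∈ = member-cases e t p y (∈U⁻ ⟨ t , p ⟩ y y∈)

    base-centre : ∀ t p x → x ∈U[ m ] ⟨ t , p ⟩ → π₂ x ≡ 0 → x ≡ p
    base-centre t p x x∈ base with ∈-cases t p x x∈
    ... | inj₁ x≡p = x≡p
    ... | inj₂ (_ , refl , _) = ⊥-elim (1≢0 (trans (sym (π₂-partner p)) base))
      where
      1≢0 : 1 ≢ 0
      1≢0 ()

    partner∈ : ∀ t p → π₂ p ≡ 0 → ¬ T (witnessed e t (π₁ p)) → partner p ∈U[ m ] ⟨ t , p ⟩
    partner∈ t p base unwitnessed = ∈U⁺ ⟨ t , p ⟩ (partner p) (member-partner e t p base unwitnessed)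

    by-centre : (P : ℕ → Set) → (∀ t p → P ⟨ t , p ⟩) → ∀ i → P i
    by-centre P P-pair i = subst P (pair-π i) (P-pair (π₁ i) (π₂ i))

    decided : ∀ i x → (m ⟦ ⟨ i , x ⟩ ⟧↓ 0) ⊎ (x ∈U[ m ] i)
    decided i x = by-value (member e i x) (member-computes (i , x))
      where
      by-value : ∀ b → m ⟦ ⟨ i , x ⟩ ⟧↓ boolToℕ b → (m ⟦ ⟨ i , x ⟩ ⟧↓ 0) ⊎ (m ⟦ ⟨ i , x ⟩ ⟧↓ 1)
      by-value false computes = inj₁ computes
      by-value true computes = inj₂ computes

    _⊆U_ : ℕ → ℕ → Set
    k ⊆U i = ∀ y → y ∈U[ m ] k → y ∈U[ m ] i

    within-pair : ∀ k x → π₂ x ≡ 0 → x ∈U[ m ] k → ∀ y → y ∈U[ m ] k → y ≡ x ⊎ y ≡ partner x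
    within-pair k x base = by-centre (λ k → x ∈U[ m ] k → ∀ y → y ∈U[ m ] k → y ≡ x ⊎ y ≡ partner x) centred k
      where
      centred : ∀ t p → x ∈U[ m ] ⟨ t , p ⟩ → ∀ y → y ∈U[ m ] ⟨ t , p ⟩ → y ≡ x ⊎ y ≡ partner x
      centred t p x∈ y y∈ with base-centre t p x x∈ base | ∈-cases t p y y∈
      ... | refl | inj₁ refl = inj₁ refl
      ... | refl | inj₂ (_ , refl , _) = inj₂ refl

    meet-sound : ∀ i j x → x ∈U[ m ] i → x ∈U[ m ] j →
                 x ∈U[ m ] meet e i j x × meet e i j x ⊆U i × meet e i j x ⊆U j
    meet-sound i j x x∈i x∈j with π₂ x ≟ 0
    ... | no not-base rewrite meet-other e i j x not-base = centre∈ 0 x , singleton-⊆ i x∈i , singleton-⊆ j x∈j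
      where
      singleton-⊆ : ∀ k → x ∈U[ m ] k → ⟨ 0 , x ⟩ ⊆U k
      singleton-⊆ k x∈k y y∈ with ∈-cases 0 x y y∈
      ... | inj₁ refl = x∈k
      ... | inj₂ (base , _) = ⊥-elim (not-base base)
    ... | yes base with T? (member e i (partner x))
    ... | yes partner∈i rewrite meet-inner e i j x base partner∈i = x∈j , j⊆i , λ _ y∈ → y∈
      where
      j⊆i : j ⊆U i
      j⊆i y y∈ with within-pair j x base x∈j y y∈
      ... | inj₁ refl = x∈i
      ... | inj₂ refl = ∈U⁺ i (partner x) partner∈i
    ... | no partner∉i rewrite meet-outer e i j x base partner∉i = x∈i , (λ _ y∈ → y∈) , i⊆j
      where
      i⊆j : i ⊆U j
      i⊆j y y∈ with within-pair i x base x∈i y y∈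
      ... | inj₁ refl = x∈j
      ... | inj₂ refl = ⊥-elim (partner∉i (∈U⁻ i (partner x) y∈))

    csc : IsCSC m n
    csc = Computes-total m member-computes , decided , Computes-total n (meets-computes e)
        , (λ x → ⟨ 0 , x ⟩ , centre∈ 0 x) , intersection
      where
      intersection : ∀ i j x → x ∈U[ m ] i → x ∈U[ m ] j → ∀ k → n ⟦ ⟨ i , ⟨ j , x ⟩ ⟩ ⟧↓ k →
                     x ∈U[ m ] k × (∀ y → y ∈U[ m ] k → y ∈U[ m ] i × y ∈U[ m ] j)
      intersection i j x x∈i x∈j k computes-k
        with ⇓-functional computes-k (meets-computes e (i , j , x)) | meet-sound i j x x∈i x∈j
      ... | refl | x∈k , k⊆i , k⊆j = x∈k , λ y y∈ → k⊆i y y∈ , k⊆j y y∈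

    partner-not-base : ∀ x → π₂ (partner x) ≢ 0
    partner-not-base x eq with trans (sym (π₂-partner x)) eq
    ... | ()

    t0 : IsT0 m
    t0 x y x≢y with T? (member e ⟨ 0 , x ⟩ y)
    ... | no y∉ = _∈U[ m ] ⟨ 0 , x ⟩ , basic-open m ⟨ 0 , x ⟩ , inj₁ (centre∈ 0 x , y∉ ∘ ∈U⁻ ⟨ 0 , x ⟩ y)
    ... | yes y∈ with member-cases e 0 x y y∈
    ... | inj₁ y≡x = ⊥-elim (x≢y (sym y≡x))
    ... | inj₂ (_ , refl , _) = _∈U[ m ] ⟨ 0 , y ⟩ , basic-open m ⟨ 0 , y ⟩ , inj₂ (centre∈ 0 y , x∉)
      where
      x∉ : ¬ x ∈U[ m ] ⟨ 0 , partner x ⟩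
      x∉ x∈ with ∈-cases 0 (partner x) x x∈
      ... | inj₁ x≡partner = x≢y x≡partner
      ... | inj₂ (base , _) = partner-not-base x base

    witnesses⇒T1 : (∀ a → ∃[ b ] r ⟦ ⟨ e , ⟨ a , b ⟩ ⟩ ⟧↓ 0) → IsT1 m
    witnesses⇒T1 witnesses x y x≢y with T? (member e ⟨ 0 , x ⟩ y)
    ... | no y∉ = _∈U[ m ] ⟨ 0 , x ⟩ , basic-open m ⟨ 0 , x ⟩ , centre∈ 0 x , y∉ ∘ ∈U⁻ ⟨ 0 , x ⟩ y
    ... | yes y∈ with member-cases e 0 x y y∈
    ... | inj₁ y≡x = ⊥-elim (x≢y (sym y≡x))
    ... | inj₂ (_ , refl , _) with witnesses (π₁ x)
    ... | b , zero-at = _∈U[ m ] ⟨ suc b , x ⟩ , basic-open m ⟨ suc b , x ⟩ , centre∈ (suc b) x , partner∉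
      where
      partner∉ : ¬ partner x ∈U[ m ] ⟨ suc b , x ⟩
      partner∉ partner∈ with ∈-cases (suc b) x (partner x) partner∈
      ... | inj₁ partner≡x = x≢y (sym partner≡x)
      ... | inj₂ (_ , _ , unwitnessed) = unwitnessed (witnessed⁺ e (π₁ x) b zero-at)

    T1⇒witnesses : IsT1 m → ∀ a → ∃[ b ] r ⟦ ⟨ e , ⟨ a , b ⟩ ⟩ ⟧↓ 0
    T1⇒witnesses t1 a with t1 ⟨ a , 0 ⟩ ⟨ a , 1 ⟩ (λ eq → 0≢1 (proj₂ (pair-injective {a} {0} {a} {1} eq)))
      where
      0≢1 : 0 ≢ 1
      0≢1 ()
    ... | O , O-open , u∈O , v∉O with O-open ⟨ a , 0 ⟩ u∈O
    ... | i , u∈U , U⊆O =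
      by-centre (λ i → ⟨ a , 0 ⟩ ∈U[ m ] i → ¬ ⟨ a , 1 ⟩ ∈U[ m ] i → ∃[ b ] r ⟦ ⟨ e , ⟨ a , b ⟩ ⟩ ⟧↓ 0)
                witness-from-basic i u∈U (v∉O ∘ U⊆O ⟨ a , 1 ⟩)
      where
      witness-from-basic : ∀ t p → ⟨ a , 0 ⟩ ∈U[ m ] ⟨ t , p ⟩ → ¬ ⟨ a , 1 ⟩ ∈U[ m ] ⟨ t , p ⟩ →
                           ∃[ b ] r ⟦ ⟨ e , ⟨ a , b ⟩ ⟩ ⟧↓ 0
      witness-from-basic t p u∈ v∉ with base-centre t p ⟨ a , 0 ⟩ u∈ (π₂-pair a 0)
      ... | refl with T? (witnessed e t (π₁ ⟨ a , 0 ⟩))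
      ... | yes w =
        subst (λ a → ∃[ b ] r ⟦ ⟨ e , ⟨ a , b ⟩ ⟩ ⟧↓ 0) (π₁-pair a 0) (witnessed⁻ e t (π₁ ⟨ a , 0 ⟩) w)
      ... | no unwitnessed = ⊥-elim (v∉ (subst (λ v → v ∈U[ m ] ⟨ t , ⟨ a , 0 ⟩ ⟩) (cong ⟨_, 1 ⟩ (π₁-pair a 0))
                                              (partner∈ t ⟨ a , 0 ⟩ (π₂-pair a 0) unwitnessed)))

T1-Π⁰₂-hard-within-T0 : Π⁰₂-hard-within T1-CSC T0-CSC
T1-Π⁰₂-hard-within-T0 B (r , r-total , B⇔) =
  (λ e → ⟨ basis e , meets e ⟩) , reduction-computable , λ e → space-T0 e , mk⇔ (B⇒T1 e) (T1⇒B e)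
  where
  open Hardness r r-total
  space-T0 : ∀ e → T0-CSC ⟨ basis e , meets e ⟩
  space-T0 e = basis e , meets e , refl , Space.csc e , Space.t0 e
  B⇒T1 : ∀ e → B e → T1-CSC ⟨ basis e , meets e ⟩
  B⇒T1 e Be = basis e , meets e , refl , Space.csc e , Space.witnesses⇒T1 e (Equivalence.to (B⇔ e) Be)
  T1⇒B : ∀ e → T1-CSC ⟨ basis e , meets e ⟩ → B e
  T1⇒B e (m , n , eq , _ , t1) =
    Equivalence.from (B⇔ e)
      (Space.T1⇒witnesses e (subst IsT1 (sym (proj₁ (pair-injective {basis e} {meets e} {m} {n} eq))) t1))

mainTheorem10 : Π⁰₂-complete-within T1-CSC T0-CSC
mainTheorem10 = T1-Π⁰₂-within-T0 , T1-Π⁰₂-hard-within-T0
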